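{- Let $G$ be a graph and $e$ an edge of $G$. Then \[\tau_G=\tau_{G\setminus e}-(x-1)\tau_{G/e},\] where $G\setminus e$ is $G$ with $e$ deleted and $G/e$ is the (unweighted, simple) graph obtained by contracting $e$ and removing loops and multiple edges.
   Context: All graphs are finite and simple. $X_G=\sum_\kappa\prod_{v\in V(G)}x_{\kappa(v)}$ over proper colourings $\kappa:V(G)\to\mathbb{Z}_{>0}$ is the chromatic symmetric function. For a partition $\lambda=(\lambda_1,\dots,\lambda_\ell)$, $\ell(\lambda)=\ell$ and $P_\lambda$ is the disjoint union of paths with $\lambda_1,\dots,\lambda_\ell$ vertices; $\{X_{P_\lambda}\}$ is a basis of the symmetric functions over $\mathbb{Q}$. The tree polynomial is $\tau_G(x)=\sum_\lambda a_\lambda x^{\ell(\lambda)}$ where $X_G=\sum_\lambda a_\lambda X_{P_\lambda}$. -}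

module Defs where

open import Data.Bool using (Bool; true; false; _∧_; _∨_; not; if_then_else_)
open import Data.Nat using (ℕ; zero; suc; _+_; _∸_; _⊓_; _≡ᵇ_)
open import Data.Fin using (Fin; toℕ; punchIn)
open import Data.Fin.Properties using () renaming (_≟_ to _≟ᶠ_)
open import Data.List using (List; []; _∷_; [_]; map; concatMap; filterᵇ; length; lookup; foldr; upTo; allFin)
open import Data.Bool.ListAction using (all; any)
open import Data.Nat.ListAction using (sum)
open import Data.Vec.Functional using () renaming (_∷_ to _∷ᶠ_)
open import Data.Rational using (ℚ; 0ℚ; _/_) renaming (_+_ to _+ℚ_; _*_ to _*ℚ_; _-_ to _-ℚ_)
open import Data.Integer using (+_)
open import Relation.Nullary.Decidable using (⌊_⌋)
open import Relation.Binary.PropositionalEquality using (_≡_)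

-- A graph is given by a Boolean function r; the (undirected, loopless)
-- edge relation is  i ~ j  iff  i ≠ j  and  (r i j or r j i).
-- Every simple graph on Fin n arises this way.

Graph : ℕ → Set
Graph n = Fin n → Fin n → Bool

_==ᶠ_ : ∀ {n} → Fin n → Fin n → Bool
i ==ᶠ j = ⌊ i ≟ᶠ j ⌋

isEdge : ∀ {n} → Graph n → Fin n → Fin n → Bool
isEdge G i j = not (i ==ᶠ j) ∧ (G i j ∨ G j i)

delete : ∀ {n} → Graph n → Fin n → Fin n → Graph n
delete G u v i j =
  isEdge G i j ∧ not (((i ==ᶠ u) ∧ (j ==ᶠ v)) ∨ ((i ==ᶠ v) ∧ (j ==ᶠ u)))

-- G / e, for e = uv : vertex v is merged into u.  The vertices of G / e
-- are the vertices of G other than v, indexed by Fin n via punchIn v.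
-- Loops and multiple edges are automatically discarded (simple graph).
contract : ∀ {n} → Graph (suc n) → Fin (suc n) → Fin (suc n) → Graph n
contract G u v a b =
  isEdge G a' b' ∨ (((a' ==ᶠ u) ∧ isEdge G v b') ∨ ((b' ==ᶠ u) ∧ isEdge G a' v))
  where
  a' = punchIn v a
  b' = punchIn v b

-- Disjoint union of paths P_λ on Fin (λ₁ + ... + λ_ℓ): blocks of
-- consecutive vertices of sizes λ₁, …, λ_ℓ, each block a path.

partialSums : ℕ → List ℕ → List ℕ
partialSums acc [] = []
partialSums acc (x ∷ xs) = (acc + x) ∷ partialSums (acc + x) xs

pathsGraph : (λs : List ℕ) → Graph (sum λs)
pathsGraph λs i j =
  (toℕ j ≡ᵇ suc (toℕ i)) ∧ not (any (λ s → s ≡ᵇ toℕ j) (partialSums 0 λs))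

-- Partitions of n (weakly decreasing lists of positive integers).

-- partitions of n with all parts ≤ k (first argument is fuel ≥ n)
partsBounded : ℕ → ℕ → ℕ → List (List ℕ)
partsBounded _ zero k = [ [] ]
partsBounded zero (suc n) k = []
partsBounded (suc f) (suc n) k =
  concatMap (λ p → map (p ∷_) (partsBounded f (suc n ∸ p) p))
            (map suc (upTo (k ⊓ suc n)))

partitions : ℕ → List (List ℕ)
partitions n = partsBounded n n n

-- For an exponent list α = (α₁,…,α_m), monoCoeff G α is the coefficient
-- of x₁^α₁ ⋯ x_m^α_m in X_G, i.e. the number of proper colourings
-- κ : V(G) → {1,…,m} with |κ⁻¹(c)| = α_c for every c.

allFuns : (n m : ℕ) → List (Fin n → Fin m)
allFuns zero m = [ (λ ()) ]
allFuns (suc n) m = concatMap (λ c → map (c ∷ᶠ_) (allFuns n m)) (allFin m)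

proper : ∀ {n m} → Graph n → (Fin n → Fin m) → Bool
proper {n} G κ =
  all (λ i → all (λ j → not (isEdge G i j) ∨ not (κ i ==ᶠ κ j)) (allFin n)) (allFin n)

colourCount : ∀ {n m} → (Fin n → Fin m) → Fin m → ℕ
colourCount {n} κ c = length (filterᵇ (λ i → κ i ==ᶠ c) (allFin n))

hasType : ∀ {n} (α : List ℕ) → (Fin n → Fin (length α)) → Bool
hasType α κ = all (λ c → colourCount κ c ≡ᵇ lookup α c) (allFin (length α))

monoCoeff : ∀ {n} → Graph n → List ℕ → ℕ
monoCoeff {n} G α =
  length (filterᵇ (λ κ → proper G κ ∧ hasType α κ) (allFuns n (length α)))

toℚ : ℕ → ℚ
toℚ k = + k / 1

Σℚ : {A : Set} → List A → (A → ℚ) → ℚ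
Σℚ xs f = foldr (λ x r → f x +ℚ r) 0ℚ xs

-- X_G = Σ_{λ ⊢ n} a_λ X_{P_λ}, as an identity of formal power series
-- (all monomial coefficients agree).
IsPathExpansion : ∀ {n} → Graph n → (List ℕ → ℚ) → Set
IsPathExpansion {n} G a =
  ∀ (α : List ℕ) →
    toℚ (monoCoeff G α) ≡ Σℚ (partitions n) (λ λs → a λs *ℚ toℚ (monoCoeff (pathsGraph λs) α))

-- Polynomials in x over ℚ as coefficient functions ℕ → ℚ.

Poly : Set
Poly = ℕ → ℚ

_⊖_ : Poly → Poly → Poly
(p ⊖ q) k = p k -ℚ q k

xMinus1Times : Poly → Poly
xMinus1Times p zero = 0ℚ -ℚ p zero
xMinus1Times p (suc k) = p k -ℚ p (suc k)

treePoly : ℕ → (List ℕ → ℚ) → Poly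
treePoly n a k = Σℚ (filterᵇ (λ λs → length λs ≡ᵇ k) (partitions n)) a

module Submission where

-- Setting m of the variables of X_G to 1 and the others to 0 counts the proper
-- m-colourings, and a forest of j paths on n vertices has m^j (m - 1)^(n - j) of them.  Hence the
-- path expansion of X_G gives χ_G(m) = Σ_j τ_j m^j (m - 1)^(n - j), and deletion–contraction
-- χ_{G \ e} = χ_G + χ_{G / e} turns into the claimed identity of these sums, since multiplying τ
-- by x - 1 exactly compensates for G / e having one vertex fewer.  Finally such a sum determines
-- its coefficients: as a polynomial in m it vanishes identically once it vanishes for m ≥ 2, and at
-- m = 1 only the top coefficient survives.

open import Algebra.Bundles using (CommutativeSemiring; CommutativeRing)
open import Data.Bool using (Bool; true; false; _∧_; _∨_; not; if_then_else_; T; T?)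
open import Data.List
  using (List; []; _∷_; [_]; _++_; map; concatMap; foldr; filterᵇ; length; lookup; allFin; tabulate; upTo; applyUpTo)
import Data.List.Properties as ListP
open import Data.List.Relation.Unary.All as All using (All; []; _∷_)
open import Data.Nat as ℕ using (ℕ; zero; suc; _≤_; _<_; z≤n; s≤s; _≡ᵇ_; _∸_; _⊓_)
open import Data.Nat.ListAction using (sum)
open import Function using (_∘_; Equivalence; Injective)
open import Level using (Level)
import Relation.Binary.PropositionalEquality as ≡

module ListSum {c ℓ} (R : CommutativeSemiring c ℓ) where

  open CommutativeSemiring R
  open import Relation.Binary.Reasoning.Setoid setoid
  open import Algebra.Properties.CommutativeSemigroup +-commutativeSemigroup
    using (interchange)

  private variable
    a b : Level
    A B : Set a

  ∑ : List A → (A → Carrier) → Carrier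
  ∑ xs f = foldr (λ x r → f x + r) 0# xs

  ∑-congᴬ : ∀ xs {f g : A → Carrier} → All (λ x → f x ≈ g x) xs → ∑ xs f ≈ ∑ xs g
  ∑-congᴬ [] [] = refl
  ∑-congᴬ (x ∷ xs) (e ∷ es) = +-cong e (∑-congᴬ xs es)

  ∑-cong : ∀ xs {f g : A → Carrier} → (∀ x → f x ≈ g x) → ∑ xs f ≈ ∑ xs g
  ∑-cong [] e = refl
  ∑-cong (x ∷ xs) e = +-cong (e x) (∑-cong xs e)

  ∑-zero : ∀ (xs : List A) → ∑ xs (λ _ → 0#) ≈ 0#
  ∑-zero [] = refl
  ∑-zero (x ∷ xs) = trans (+-identityˡ _) (∑-zero xs)

  ∑-++ : ∀ xs ys (f : A → Carrier) → ∑ (xs ++ ys) f ≈ ∑ xs f + ∑ ys f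
  ∑-++ [] ys f = sym (+-identityˡ _)
  ∑-++ (x ∷ xs) ys f = trans (+-congˡ (∑-++ xs ys f)) (sym (+-assoc _ _ _))

  ∑-map : ∀ xs (g : A → B) (f : B → Carrier) → ∑ (map g xs) f ≈ ∑ xs (λ x → f (g x))
  ∑-map [] g f = refl
  ∑-map (x ∷ xs) g f = +-congˡ (∑-map xs g f)

  ∑-concatMap : ∀ xs (g : A → List B) (f : B → Carrier) →
                ∑ (concatMap g xs) f ≈ ∑ xs (λ x → ∑ (g x) f)
  ∑-concatMap [] g f = refl
  ∑-concatMap (x ∷ xs) g f = trans (∑-++ (g x) _ f) (+-congˡ (∑-concatMap xs g f))

  ∑-distrib-+ : ∀ xs (f g : A → Carrier) → ∑ xs (λ x → f x + g x) ≈ ∑ xs f + ∑ xs g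
  ∑-distrib-+ [] f g = sym (+-identityˡ 0#)
  ∑-distrib-+ (x ∷ xs) f g = trans (+-congˡ (∑-distrib-+ xs f g)) (interchange _ _ _ _)

  ∑-distribˡ : ∀ xs (k : Carrier) (f : A → Carrier) → ∑ xs (λ x → k * f x) ≈ k * ∑ xs f
  ∑-distribˡ [] k f = sym (zeroʳ k)
  ∑-distribˡ (x ∷ xs) k f = trans (+-congˡ (∑-distribˡ xs k f)) (sym (distribˡ k _ _))

  ∑-distribʳ : ∀ xs (k : Carrier) (f : A → Carrier) → ∑ xs (λ x → f x * k) ≈ ∑ xs f * k
  ∑-distribʳ [] k f = sym (zeroˡ k)
  ∑-distribʳ (x ∷ xs) k f = trans (+-congˡ (∑-distribʳ xs k f)) (sym (distribʳ k _ _))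

  ∑-comm : ∀ xs (ys : List B) (f : A → B → Carrier) →
           ∑ xs (λ x → ∑ ys (f x)) ≈ ∑ ys (λ y → ∑ xs (λ x → f x y))
  ∑-comm [] ys f = sym (∑-zero ys)
  ∑-comm (x ∷ xs) ys f = trans (+-congˡ (∑-comm xs ys f)) (sym (∑-distrib-+ ys (f x) _))

  ∑-filterᵇ : ∀ (p : A → Bool) xs (f : A → Carrier) →
              ∑ (filterᵇ p xs) f ≈ ∑ xs (λ x → if p x then f x else 0#)
  ∑-filterᵇ p [] f = refl
  ∑-filterᵇ p (x ∷ xs) f with p x
  ... | true  = +-congˡ (∑-filterᵇ p xs f)
  ... | false = trans (∑-filterᵇ p xs f) (sym (+-identityˡ _))

  ∑-upTo-suc : ∀ M (f : ℕ → Carrier) → ∑ (upTo (suc M)) f ≈ f 0 + ∑ (upTo M) (f ∘ suc)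
  ∑-upTo-suc M f = +-congˡ (begin
    ∑ (applyUpTo suc M) f       ≡⟨ ≡.cong (λ xs → ∑ xs f) (ListP.map-applyUpTo (λ k → k) suc M) ⟨
    ∑ (map suc (upTo M)) f      ≈⟨ ∑-map (upTo M) suc f ⟩
    ∑ (upTo M) (f ∘ suc)        ∎)

  ∑-upTo-∷ʳ : ∀ M (f : ℕ → Carrier) → ∑ (upTo (suc M)) f ≈ ∑ (upTo M) f + f M
  ∑-upTo-∷ʳ M f = begin
    ∑ (upTo (suc M)) f          ≡⟨ ≡.cong (λ xs → ∑ xs f) (ListP.upTo-∷ʳ M) ⟨
    ∑ (upTo M ++ [ M ]) f       ≈⟨ ∑-++ (upTo M) [ M ] f ⟩
    ∑ (upTo M) f + (f M + 0#)   ≈⟨ +-congˡ (+-identityʳ (f M)) ⟩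
    ∑ (upTo M) f + f M          ∎

  ∑-upTo-ifᵇ : ∀ {i M} → i < M → (f : ℕ → Carrier) →
               ∑ (upTo M) (λ k → if i ≡ᵇ k then f k else 0#) ≈ f i
  ∑-upTo-ifᵇ {zero} {suc M} _ f = trans (∑-upTo-suc M _)
    (trans (+-congˡ (∑-zero (upTo M))) (+-identityʳ (f 0)))
  ∑-upTo-ifᵇ {suc i} {suc M} (s≤s i<M) f = trans (∑-upTo-suc M _)
    (trans (+-identityˡ _) (∑-upTo-ifᵇ i<M (f ∘ suc)))

  ∑-groupBy : ∀ (h : A → ℕ) {M} xs → All (λ x → h x < M) xs → (f : A → Carrier) (g : ℕ → Carrier) →
              ∑ xs (λ x → f x * g (h x)) ≈ ∑ (upTo M) (λ k → ∑ (filterᵇ (λ x → h x ≡ᵇ k) xs) f * g k)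
  ∑-groupBy h {M} xs h< f g = sym (begin
    ∑ (upTo M) (λ k → ∑ (filterᵇ (λ x → h x ≡ᵇ k) xs) f * g k)
      ≈⟨ ∑-cong (upTo M) (λ k → trans (*-congʳ (∑-filterᵇ _ xs f)) (sym (∑-distribʳ xs (g k) _))) ⟩
    ∑ (upTo M) (λ k → ∑ xs (λ x → (if h x ≡ᵇ k then f x else 0#) * g k))
      ≈⟨ ∑-comm xs (upTo M) _ ⟨
    ∑ xs (λ x → ∑ (upTo M) (λ k → (if h x ≡ᵇ k then f x else 0#) * g k))
      ≈⟨ ∑-cong xs (λ x → ∑-cong (upTo M) (λ k → if-*ʳ (h x ≡ᵇ k))) ⟩
    ∑ xs (λ x → ∑ (upTo M) (λ k → if h x ≡ᵇ k then f x * g k else 0#))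
      ≈⟨ ∑-congᴬ xs (All.map (λ hx< → ∑-upTo-ifᵇ hx< _) h<) ⟩
    ∑ xs (λ x → f x * g (h x)) ∎)
    where
    if-*ʳ : ∀ {x y} b → (if b then x else 0#) * y ≈ (if b then x * y else 0#)
    if-*ʳ true  = refl
    if-*ʳ false = zeroˡ _

open import Defs
import Data.Bool.Properties as BoolP
open import Data.Bool.ListAction using (all; and; any; or)
open import Data.Empty using (⊥; ⊥-elim)
open import Data.Fin using (Fin; zero; suc; toℕ; punchIn; punchOut)
import Data.Fin.Properties as FinP
open import Data.Fin.Properties using () renaming (_≟_ to _≟ᶠ_)
import Data.Integer as ℤ
import Data.Integer.Properties as ℤP
import Data.List.Relation.Unary.All.Properties as AllP
import Data.Nat.Properties as ℕP
open import Data.Nat.Solver using () renaming (module +-*-Solver to ℕ-Solver)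
open import Data.Nat.Coprimality using (1-coprimeTo) renaming (sym to coprime-sym)
open import Data.Product using (_×_; _,_; proj₁; proj₂; ∃₂)
open import Data.Rational as ℚ using (ℚ; 0ℚ; 1ℚ; _+_; _*_; _-_; -_; 1/_)
import Data.Rational.Properties as ℚP
open import Data.Rational.Solver using () renaming (module +-*-Solver to ℚ-Solver)
open import Algebra.Properties.Semiring.Exp (CommutativeRing.semiring ℚP.+-*-commutativeRing) using (_^_; ^-homo-*)
import Data.Rational.Unnormalised as ℚᵘ
import Data.Rational.Unnormalised.Properties as ℚᵘP
open import Data.Sum using (_⊎_; inj₁; inj₂; [_,_]′)
open import Data.Vec.Functional using (insertAt) renaming (_∷_ to _∷ᶠ_)
open import Data.Vec.Functional.Properties using (insertAt-lookup; insertAt-punchIn)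
open import Relation.Nullary using (¬_; Dec; yes; no)
open import Relation.Nullary.Decidable using (map′; toWitness; fromWitness; toWitnessFalse; fromWitnessFalse)
open ≡ hiding ([_])

module ℕ∑ = ListSum ℕP.+-*-commutativeSemiring
module ℚ∑ = ListSum (CommutativeRing.commutativeSemiring ℚP.+-*-commutativeRing)

𝟙 : Bool → ℕ
𝟙 b = if b then 1 else 0

T-injective : ∀ {a b} → (T a → T b) → (T b → T a) → a ≡ b
T-injective {false} {false} _ _ = refl
T-injective {false} {true}  _ g = ⊥-elim (g _)
T-injective {true}  {false} f _ = ⊥-elim (f _)
T-injective {true}  {true}  _ _ = refl

𝟙-split : ∀ a b → 𝟙 a ≡ 𝟙 (a ∧ not b) ℕ.+ 𝟙 (a ∧ b)
𝟙-split false _     = refl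
𝟙-split true  false = refl
𝟙-split true  true  = refl

T-not-∨-not⁺ : ∀ {a b} → T (not a ∨ not b) → T a → T b → ⊥
T-not-∨-not⁺ {true} {true} ()

T-not-∨-not⁻ : ∀ {a b} → (T a → T b → ⊥) → T (not a ∨ not b)
T-not-∨-not⁻ {false}          _ = _
T-not-∨-not⁻ {true}  {false}  _ = _
T-not-∨-not⁻ {true}  {true}   f = f _ _

T-∧⁺ : ∀ {a b} → T (a ∧ b) → T a × T b
T-∧⁺ = Equivalence.to BoolP.T-∧

T-∧⁻ : ∀ {a b} → T a → T b → T (a ∧ b)
T-∧⁻ ta tb = Equivalence.from BoolP.T-∧ (ta , tb)

T-∨⁺ : ∀ {a b} → T (a ∨ b) → T a ⊎ T b
T-∨⁺ = Equivalence.to BoolP.T-∨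

T-∨⁻ˡ : ∀ {a} b → T a → T (a ∨ b)
T-∨⁻ˡ {true} _ _ = _

T-∨⁻ʳ : ∀ a {b} → T b → T (a ∨ b)
T-∨⁻ʳ true  _ = _
T-∨⁻ʳ false t = t

T-not⁺ : ∀ {a} → T (not a) → ¬ T a
T-not⁺ {false} _ ()

T-not⁻ : ∀ {a} → ¬ T a → T (not a)
T-not⁻ {false} _ = _
T-not⁻ {true}  f = f _

toℚᵘ-toℚ : ∀ k → ℚ.toℚᵘ (toℚ k) ≡ ℚᵘ.mkℚᵘ (ℤ.+ k) 0
toℚᵘ-toℚ k = cong ℚ.toℚᵘ (ℚP.normalize-coprime (coprime-sym (1-coprimeTo k)))

toℚ-+ : ∀ a b → toℚ (a ℕ.+ b) ≡ toℚ a + toℚ b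
toℚ-+ a b = ℚP.toℚᵘ-injective (begin
  ℚ.toℚᵘ (toℚ (a ℕ.+ b))
    ≡⟨ toℚᵘ-toℚ (a ℕ.+ b) ⟩
  ℚᵘ.mkℚᵘ (ℤ.+ (a ℕ.+ b)) 0
    ≈⟨ ℚᵘ.*≡* (cong (ℤ._* ℤ.+ 1) (sym (cong₂ ℤ._+_ (ℤP.*-identityʳ (ℤ.+ a)) (ℤP.*-identityʳ (ℤ.+ b))))) ⟩
  ℚᵘ.mkℚᵘ (ℤ.+ a) 0 ℚᵘ.+ ℚᵘ.mkℚᵘ (ℤ.+ b) 0
    ≡⟨ cong₂ ℚᵘ._+_ (toℚᵘ-toℚ a) (toℚᵘ-toℚ b) ⟨
  ℚ.toℚᵘ (toℚ a) ℚᵘ.+ ℚ.toℚᵘ (toℚ b)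
    ≈⟨ ℚP.toℚᵘ-homo-+ (toℚ a) (toℚ b) ⟨
  ℚ.toℚᵘ (toℚ a + toℚ b) ∎)
  where open ℚᵘP.≃-Reasoning

toℚ-* : ∀ a b → toℚ (a ℕ.* b) ≡ toℚ a * toℚ b
toℚ-* a b = ℚP.toℚᵘ-injective (begin
  ℚ.toℚᵘ (toℚ (a ℕ.* b))
    ≡⟨ toℚᵘ-toℚ (a ℕ.* b) ⟩
  ℚᵘ.mkℚᵘ (ℤ.+ (a ℕ.* b)) 0
    ≈⟨ ℚᵘ.*≡* (cong (ℤ._* ℤ.+ 1) (ℤP.pos-* a b)) ⟩
  ℚᵘ.mkℚᵘ (ℤ.+ a) 0 ℚᵘ.* ℚᵘ.mkℚᵘ (ℤ.+ b) 0
    ≡⟨ cong₂ ℚᵘ._*_ (toℚᵘ-toℚ a) (toℚᵘ-toℚ b) ⟨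
  ℚ.toℚᵘ (toℚ a) ℚᵘ.* ℚ.toℚᵘ (toℚ b)
    ≈⟨ ℚP.toℚᵘ-homo-* (toℚ a) (toℚ b) ⟨
  ℚ.toℚᵘ (toℚ a * toℚ b) ∎)
  where open ℚᵘP.≃-Reasoning

toℚ-injective : ∀ {a b} → toℚ a ≡ toℚ b → a ≡ b
toℚ-injective {a} {b} eq = ℤP.+-injective (begin
  ℤ.+ a                    ≡⟨ cong ℚᵘ.↥_ (toℚᵘ-toℚ a) ⟨
  ℚᵘ.↥ (ℚ.toℚᵘ (toℚ a))    ≡⟨ cong (ℚᵘ.↥_ ∘ ℚ.toℚᵘ) eq ⟩
  ℚᵘ.↥ (ℚ.toℚᵘ (toℚ b))    ≡⟨ cong ℚᵘ.↥_ (toℚᵘ-toℚ b) ⟩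
  ℤ.+ b                    ∎)
  where open ≡-Reasoning

toℚ-∑ : ∀ {A : Set} xs (f : A → ℕ) → toℚ (ℕ∑.∑ xs f) ≡ Σℚ xs (toℚ ∘ f)
toℚ-∑ [] f = refl
toℚ-∑ (x ∷ xs) f = trans (toℚ-+ (f x) _) (cong (toℚ (f x) +_) (toℚ-∑ xs f))

==ᶠ-sym : ∀ {n} (i j : Fin n) → (i ==ᶠ j) ≡ (j ==ᶠ i)
==ᶠ-sym i j = T-injective (fromWitness ∘ sym ∘ toWitness) (fromWitness ∘ sym ∘ toWitness)

==ᶠ-suc : ∀ {n} (i j : Fin n) → (suc i ==ᶠ suc j) ≡ (i ==ᶠ j)
==ᶠ-suc i j = T-injective (fromWitness ∘ FinP.suc-injective ∘ toWitness) (fromWitness ∘ cong suc ∘ toWitness)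

isEdge-sym : ∀ {n} (G : Graph n) i j → isEdge G i j ≡ isEdge G j i
isEdge-sym G i j = cong₂ (λ b c → not b ∧ c) (==ᶠ-sym i j) (BoolP.∨-comm (G i j) (G j i))

isEdge-irrefl : ∀ {n} (G : Graph n) {i j} → T (isEdge G i j) → i ≢ j
isEdge-irrefl G {i} {j} e = toWitnessFalse {a? = i ≟ᶠ j} (proj₁ (T-∧⁺ {not (i ==ᶠ j)} e))

Proper : ∀ {n m} → Graph n → (Fin n → Fin m) → Set
Proper G κ = ∀ {i j} → T (isEdge G i j) → κ i ≢ κ j

proper⇒Proper : ∀ {n m} (G : Graph n) (κ : Fin n → Fin m) → T (proper G κ) → Proper G κ
proper⇒Proper {n} G κ t {i} {j} e κi≡κj =
  T-not-∨-not⁺ (AllP.tabulate⁻ (AllP.all⁺ _ _ (AllP.tabulate⁻ (AllP.all⁺ _ _ t) i)) j) e (fromWitness κi≡κj)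

Proper⇒proper : ∀ {n m} (G : Graph n) (κ : Fin n → Fin m) → Proper G κ → T (proper G κ)
Proper⇒proper {n} G κ P =
  AllP.all⁻ (λ i → all (good i) (allFin n)) (AllP.tabulate⁺ {f = λ k → k} λ i →
  AllP.all⁻ (good i) (AllP.tabulate⁺ {f = λ k → k} λ j → T-not-∨-not⁻ {isEdge G i j} (λ e eq → P e (toWitness eq))))
  where
  good : Fin n → Fin n → Bool
  good i j = not (isEdge G i j) ∨ not (κ i ==ᶠ κ j)

Proper-resp : ∀ {n m} {G H : Graph n} {κ κ′ : Fin n → Fin m} →
              (∀ {i j} → T (isEdge H i j) → T (isEdge G i j)) → κ ≗ κ′ → Proper G κ → Proper H κ′
Proper-resp H⊆G κ≗κ′ P e eq = P (H⊆G e) (trans (κ≗κ′ _) (trans eq (sym (κ≗κ′ _))))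

proper-cong : ∀ {n m} (G H : Graph n) {κ κ′ : Fin n → Fin m} →
              (∀ i j → isEdge G i j ≡ isEdge H i j) → κ ≗ κ′ → proper G κ ≡ proper H κ′
proper-cong G H {κ} {κ′} G≡H κ≗κ′ = T-injective
  (Proper⇒proper H κ′ ∘ Proper-resp {G = G} {H} (subst T (sym (G≡H _ _))) κ≗κ′ ∘ proper⇒Proper G κ)
  (Proper⇒proper G κ ∘ Proper-resp {G = H} {G} (subst T (G≡H _ _)) (sym ∘ κ≗κ′) ∘ proper⇒Proper H κ′)

open ℕ∑

χ : ∀ {n} → Graph n → ℕ → ℕ
χ {n} G m = ∑ (allFuns n m) (𝟙 ∘ proper G)

χ-cong : ∀ {n} (G H : Graph n) → (∀ i j → G i j ≡ H i j) → ∀ m → χ G m ≡ χ H m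
χ-cong {n} G H G≡H m = ∑-cong (allFuns n m) λ κ → cong 𝟙 (proper-cong G H isEdge-≡ (λ _ → refl))
  where
  isEdge-≡ : ∀ i j → isEdge G i j ≡ isEdge H i j
  isEdge-≡ i j = cong₂ (λ a b → not (i ==ᶠ j) ∧ (a ∨ b)) (G≡H i j) (G≡H j i)

∑-allFin-suc : ∀ m (f : Fin (suc m) → ℕ) → ∑ (allFin (suc m)) f ≡ f zero ℕ.+ ∑ (allFin m) (f ∘ suc)
∑-allFin-suc m f = cong (f zero ℕ.+_)
  (trans (cong (λ cs → ∑ cs f) (sym (ListP.map-tabulate (λ c → c) suc))) (∑-map (allFin m) suc f))

∑-allFin-1 : ∀ m → ∑ (allFin m) (λ _ → 1) ≡ m
∑-allFin-1 zero    = refl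
∑-allFin-1 (suc m) = trans (∑-allFin-suc m (λ _ → 1)) (cong suc (∑-allFin-1 m))

∑-allFin-== : ∀ {m} (d : Fin m) → ∑ (allFin m) (λ c → 𝟙 (c ==ᶠ d)) ≡ 1
∑-allFin-== {suc m} zero    = trans (∑-allFin-suc m (λ c → 𝟙 (c ==ᶠ zero))) (cong suc (∑-zero (allFin m)))
∑-allFin-== {suc m} (suc d) = trans (∑-allFin-suc m (λ c → 𝟙 (c ==ᶠ suc d)))
  (trans (∑-cong (allFin m) (λ c → cong 𝟙 (==ᶠ-suc c d))) (∑-allFin-== d))

∑-allFin-∧== : ∀ {m} b (d : Fin m) → ∑ (allFin m) (λ c → 𝟙 (b ∧ (d ==ᶠ c))) ≡ 𝟙 b
∑-allFin-∧== {m} false d = ∑-zero (allFin m)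
∑-allFin-∧== {m} true  d = trans (∑-cong (allFin m) (λ c → cong 𝟙 (==ᶠ-sym d c))) (∑-allFin-== d)

∑-allFin-≢ : ∀ {m} (d : Fin (suc m)) → ∑ (allFin (suc m)) (λ c → 𝟙 (not (c ==ᶠ d))) ≡ m
∑-allFin-≢ {m} d = ℕP.+-cancelʳ-≡ 1 _ _ (begin
  ∑ cs (λ c → 𝟙 (not (c ==ᶠ d))) ℕ.+ 1
    ≡⟨ cong (∑ cs (λ c → 𝟙 (not (c ==ᶠ d))) ℕ.+_) (∑-allFin-== d) ⟨
  ∑ cs (λ c → 𝟙 (not (c ==ᶠ d))) ℕ.+ ∑ cs (λ c → 𝟙 (c ==ᶠ d))
    ≡⟨ ∑-distrib-+ cs (λ c → 𝟙 (not (c ==ᶠ d))) (λ c → 𝟙 (c ==ᶠ d)) ⟨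
  ∑ cs (λ c → 𝟙 (not (c ==ᶠ d)) ℕ.+ 𝟙 (c ==ᶠ d))
    ≡⟨ ∑-cong cs (λ c → 𝟙-not-+ (c ==ᶠ d)) ⟩
  ∑ cs (λ _ → 1)
    ≡⟨ ∑-allFin-1 (suc m) ⟩
  suc m
    ≡⟨ ℕP.+-comm 1 m ⟩
  m ℕ.+ 1 ∎)
  where
  open ≡-Reasoning
  cs : List (Fin (suc m))
  cs = allFin (suc m)
  𝟙-not-+ : ∀ b → 𝟙 (not b) ℕ.+ 𝟙 b ≡ 1
  𝟙-not-+ false = refl
  𝟙-not-+ true  = refl

∑-allFuns-∷ : ∀ n m (h : (Fin (suc n) → Fin m) → ℕ) →
              ∑ (allFuns (suc n) m) h ≡ ∑ (allFin m) (λ c → ∑ (allFuns n m) (λ κ → h (c ∷ᶠ κ)))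
∑-allFuns-∷ n m h =
  trans (∑-concatMap (allFin m) _ h) (∑-cong (allFin m) (λ c → ∑-map (allFuns n m) (c ∷ᶠ_) h))

∑-allFuns-insertAt : ∀ n m (v : Fin (suc n)) (h : (Fin (suc n) → Fin m) → ℕ) →
                     (∀ {κ κ′} → κ ≗ κ′ → h κ ≡ h κ′) →
                     ∑ (allFuns (suc n) m) h ≡
                     ∑ (allFin m) (λ c → ∑ (allFuns n m) (λ κ → h (insertAt κ v c)))
∑-allFuns-insertAt n m zero h h-cong = trans (∑-allFuns-∷ n m h)
  (∑-cong (allFin m) λ c → ∑-cong (allFuns n m) λ κ → h-cong λ { zero → refl ; (suc j) → refl })
∑-allFuns-insertAt (suc n) m (suc v) h h-cong = begin
  ∑ (allFuns (suc (suc n)) m) h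
    ≡⟨ ∑-allFuns-∷ (suc n) m h ⟩
  ∑ cs (λ c → ∑ (allFuns (suc n) m) (λ κ → h (c ∷ᶠ κ)))
    ≡⟨ ∑-cong cs (λ c → ∑-allFuns-insertAt n m v (λ κ → h (c ∷ᶠ κ))
         λ κ≗κ′ → h-cong λ { zero → refl ; (suc j) → κ≗κ′ j }) ⟩
  ∑ cs (λ c → ∑ cs (λ d → ∑ (allFuns n m) (λ κ → h (c ∷ᶠ insertAt κ v d))))
    ≡⟨ ∑-comm cs cs _ ⟩
  ∑ cs (λ d → ∑ cs (λ c → ∑ (allFuns n m) (λ κ → h (c ∷ᶠ insertAt κ v d))))
    ≡⟨ ∑-cong cs (λ d → ∑-cong cs λ c → ∑-cong (allFuns n m) λ κ →
         h-cong λ { zero → refl ; (suc j) → refl }) ⟩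
  ∑ cs (λ d → ∑ cs (λ c → ∑ (allFuns n m) (λ κ → h (insertAt (c ∷ᶠ κ) (suc v) d))))
    ≡⟨ ∑-cong cs (λ d → ∑-allFuns-∷ n m (λ κ → h (insertAt κ (suc v) d))) ⟨
  ∑ cs (λ d → ∑ (allFuns (suc n) m) (λ κ → h (insertAt κ (suc v) d))) ∎
  where
  open ≡-Reasoning
  cs : List (Fin m)
  cs = allFin m

-- Deletion–contraction

data PunchInView {n} (v : Fin (suc n)) : Fin (suc n) → Set where
  at-v    : PunchInView v v
  punched : ∀ a → PunchInView v (punchIn v a)

punchInView : ∀ {n} (v j : Fin (suc n)) → PunchInView v j
punchInView v j with v ≟ᶠ j
... | yes refl = at-v
... | no v≢j   = subst (PunchInView v) (FinP.punchIn-punchOut v≢j) (punched (punchOut v≢j))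

SamePair : ∀ {n} → Fin n → Fin n → Fin n → Fin n → Set
SamePair u v i j = (i ≡ u × j ≡ v) ⊎ (i ≡ v × j ≡ u)

module DeletionContraction {n} (G : Graph (suc n)) {u v : Fin (suc n)} (uv : T (isEdge G u v)) where

  D : Graph (suc n)
  D = delete G u v

  C : Graph n
  C = contract G u v

  private
    ==ᶠ-pair⁺ : ∀ {i j a b : Fin (suc n)} → T ((i ==ᶠ a) ∧ (j ==ᶠ b)) → i ≡ a × j ≡ b
    ==ᶠ-pair⁺ {i} {j} {a} {b} t with T-∧⁺ {i ==ᶠ a} t
    ... | p , q = toWitness p , toWitness q

    samePairᵇ : Fin (suc n) → Fin (suc n) → Bool
    samePairᵇ i j = ((i ==ᶠ u) ∧ (j ==ᶠ v)) ∨ ((i ==ᶠ v) ∧ (j ==ᶠ u))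

    samePairᵇ⁺ : ∀ {i j} → T (samePairᵇ i j) → SamePair u v i j
    samePairᵇ⁺ {i} {j} t with T-∨⁺ {(i ==ᶠ u) ∧ (j ==ᶠ v)} t
    ... | inj₁ t′ = inj₁ (==ᶠ-pair⁺ t′)
    ... | inj₂ t′ = inj₂ (==ᶠ-pair⁺ t′)

    samePairᵇ⁻ : ∀ {i j} → SamePair u v i j → T (samePairᵇ i j)
    samePairᵇ⁻ (inj₁ (refl , refl)) =
      T-∨⁻ˡ ((u ==ᶠ v) ∧ (v ==ᶠ u)) (T-∧⁻ (fromWitness {a? = u ≟ᶠ u} refl) (fromWitness {a? = v ≟ᶠ v} refl))
    samePairᵇ⁻ (inj₂ (refl , refl)) =
      T-∨⁻ʳ ((v ==ᶠ u) ∧ (u ==ᶠ v)) (T-∧⁻ (fromWitness {a? = v ≟ᶠ v} refl) (fromWitness {a? = u ≟ᶠ u} refl))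

  SamePair? : ∀ i j → Dec (SamePair u v i j)
  SamePair? i j = map′ samePairᵇ⁺ samePairᵇ⁻ (T? (samePairᵇ i j))

  SamePair-sym : ∀ {i j} → SamePair u v i j → SamePair u v j i
  SamePair-sym (inj₁ (i≡u , j≡v)) = inj₂ (j≡v , i≡u)
  SamePair-sym (inj₂ (i≡v , j≡u)) = inj₁ (j≡u , i≡v)

  delete-edge⁺ : ∀ {i j} → T (isEdge D i j) → T (isEdge G i j) × ¬ SamePair u v i j
  delete-edge⁺ {i} {j} t with T-∨⁺ {D i j} (proj₂ (T-∧⁺ {not (i ==ᶠ j)} t))
  ... | inj₁ t′ = proj₁ (T-∧⁺ t′) , T-not⁺ (proj₂ (T-∧⁺ {isEdge G i j} t′)) ∘ samePairᵇ⁻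
  ... | inj₂ t′ = subst T (isEdge-sym G j i) (proj₁ (T-∧⁺ t′)) ,
                  T-not⁺ (proj₂ (T-∧⁺ {isEdge G j i} t′)) ∘ samePairᵇ⁻ ∘ SamePair-sym

  delete-edge⁻ : ∀ {i j} → T (isEdge G i j) → ¬ SamePair u v i j → T (isEdge D i j)
  delete-edge⁻ {i} {j} e ¬uv = T-∧⁻ (fromWitnessFalse (isEdge-irrefl G e))
    (T-∨⁻ˡ (D j i) (T-∧⁻ e (T-not⁻ (¬uv ∘ samePairᵇ⁺))))

  u≢v : u ≢ v
  u≢v = isEdge-irrefl G uv

  u′ : Fin n
  u′ = punchOut (u≢v ∘ sym)

  punchIn-u′ : punchIn v u′ ≡ u
  punchIn-u′ = FinP.punchIn-punchOut (u≢v ∘ sym)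

  punchIn-u′ᵇ : T (punchIn v u′ ==ᶠ u)
  punchIn-u′ᵇ = fromWitness punchIn-u′

  -- the vertex map G → G / e, recalling that G / e numbers the vertices other than v by punchIn v
  merge : Fin (suc n) → Fin n
  merge = insertAt (λ a → a) v u′

  merge-v : merge v ≡ u′
  merge-v = insertAt-lookup (λ a → a) v u′

  merge-punchIn : ∀ a → merge (punchIn v a) ≡ a
  merge-punchIn = insertAt-punchIn (λ a → a) v u′

  punchIn≡u⇒≡u′ : ∀ {a} → punchIn v a ≡ u → a ≡ u′
  punchIn≡u⇒≡u′ {a} eq =
    trans (sym (merge-punchIn a)) (trans (cong merge (trans eq (sym punchIn-u′))) (merge-punchIn u′))

  merge-identifies : ∀ {i j} → merge i ≡ merge j → i ≡ j ⊎ SamePair u v i j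
  merge-identifies {i} {j} eq with punchInView v i | punchInView v j
  ... | at-v      | at-v      = inj₁ refl
  ... | at-v      | punched b = inj₂ (inj₂ (refl , trans (cong (punchIn v) b≡u′) punchIn-u′))
    where
    b≡u′ : b ≡ u′
    b≡u′ = trans (sym (merge-punchIn b)) (trans (sym eq) merge-v)
  ... | punched a | at-v      = inj₂ (inj₁ (trans (cong (punchIn v) a≡u′) punchIn-u′ , refl))
    where
    a≡u′ : a ≡ u′
    a≡u′ = trans (sym (merge-punchIn a)) (trans eq merge-v)
  ... | punched a | punched b = inj₁ (cong (punchIn v) (trans (sym (merge-punchIn a)) (trans eq (merge-punchIn b))))

  merge-≢ : ∀ {i j} → T (isEdge G i j) → ¬ SamePair u v i j → merge i ≢ merge j
  merge-≢ e ¬uv eq with merge-identifies eq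
  ... | inj₁ i≡j = isEdge-irrefl G e i≡j
  ... | inj₂ uv′ = ¬uv uv′

  merge-SamePair : ∀ {i j} → SamePair u v i j → merge i ≡ merge j
  merge-SamePair (inj₁ (refl , refl)) =
    trans (cong merge (sym punchIn-u′)) (trans (merge-punchIn u′) (sym merge-v))
  merge-SamePair (inj₂ (refl , refl)) =
    trans merge-v (trans (sym (merge-punchIn u′)) (cong merge punchIn-u′))

  contract⁺ : ∀ {a b} → T (contract G u v a b) → ∃₂ λ i j → T (isEdge G i j) × merge i ≡ a × merge j ≡ b
  contract⁺ {a} {b} t with T-∨⁺ {isEdge G (punchIn v a) (punchIn v b)} t
  ... | inj₁ e = punchIn v a , punchIn v b , e , merge-punchIn a , merge-punchIn b
  ... | inj₂ t′ with T-∨⁺ {(punchIn v a ==ᶠ u) ∧ isEdge G v (punchIn v b)} t′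
  ...   | inj₁ t″ with T-∧⁺ {punchIn v a ==ᶠ u} t″
  ...     | a′≡u , e = v , punchIn v b , e , trans merge-v (sym (punchIn≡u⇒≡u′ (toWitness a′≡u))) , merge-punchIn b
  contract⁺ {a} {b} t | inj₂ t′ | inj₂ t″ with T-∧⁺ {punchIn v b ==ᶠ u} t″
  ...     | b′≡u , e = punchIn v a , v , e , merge-punchIn a , trans merge-v (sym (punchIn≡u⇒≡u′ (toWitness b′≡u)))

  contract⁻ : ∀ {i j} → T (isEdge G i j) → T (contract G u v (merge i) (merge j))
  contract⁻ {i} {j} e with punchInView v i | punchInView v j
  ... | at-v      | at-v      = ⊥-elim (isEdge-irrefl G e refl)
  ... | at-v      | punched b = subst₂ (λ a b → T (contract G u v a b)) (sym merge-v) (sym (merge-punchIn b))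
    (T-∨⁻ʳ (isEdge G (punchIn v u′) (punchIn v b))
      (T-∨⁻ˡ ((punchIn v b ==ᶠ u) ∧ isEdge G (punchIn v u′) v) (T-∧⁻ punchIn-u′ᵇ e)))
  ... | punched a | at-v      = subst₂ (λ a b → T (contract G u v a b)) (sym (merge-punchIn a)) (sym merge-v)
    (T-∨⁻ʳ (isEdge G (punchIn v a) (punchIn v u′))
      (T-∨⁻ʳ ((punchIn v a ==ᶠ u) ∧ isEdge G v (punchIn v u′)) (T-∧⁻ punchIn-u′ᵇ e)))
  ... | punched a | punched b = subst₂ (λ a b → T (contract G u v a b)) (sym (merge-punchIn a)) (sym (merge-punchIn b))
    (T-∨⁻ˡ (((punchIn v a ==ᶠ u) ∧ isEdge G v (punchIn v b)) ∨ ((punchIn v b ==ᶠ u) ∧ isEdge G (punchIn v a) v)) e)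

  contract-edge⁺ : ∀ {a b} → T (isEdge C a b) → a ≢ b × ∃₂ λ i j → T (isEdge G i j) × merge i ≡ a × merge j ≡ b
  contract-edge⁺ {a} {b} t with T-∧⁺ {not (a ==ᶠ b)} t
  ... | a≢b , t′ with T-∨⁺ {contract G u v a b} t′
  ...   | inj₁ c = toWitnessFalse a≢b , contract⁺ c
  ...   | inj₂ c with contract⁺ c
  ...     | i , j , e , i↦b , j↦a = toWitnessFalse a≢b , j , i , subst T (isEdge-sym G i j) e , j↦a , i↦b

  contract-edge⁻ : ∀ {i j} → T (isEdge G i j) → merge i ≢ merge j → T (isEdge C (merge i) (merge j))
  contract-edge⁻ {i} {j} e mi≢mj =
    T-∧⁻ (fromWitnessFalse mi≢mj) (T-∨⁻ˡ (contract G u v (merge j) (merge i)) (contract⁻ e))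

  proper-delete : ∀ {m} (κ : Fin (suc n) → Fin m) → proper G κ ≡ proper D κ ∧ not (κ u ==ᶠ κ v)
  proper-delete κ = T-injective to from
    where
    to : T (proper G κ) → T (proper D κ ∧ not (κ u ==ᶠ κ v))
    to t = T-∧⁻ (Proper⇒proper D κ (Proper-resp {G = G} {D} (proj₁ ∘ delete-edge⁺) (λ _ → refl) P))
                (fromWitnessFalse (P uv))
      where
      P : Proper G κ
      P = proper⇒Proper G κ t
    from : T (proper D κ ∧ not (κ u ==ᶠ κ v)) → T (proper G κ)
    from t with T-∧⁺ {proper D κ} t
    ... | pD , κu≢κv = Proper⇒proper G κ edge-ok
      where
      edge-ok : Proper G κ
      edge-ok {i} {j} e with SamePair? i j
      ... | yes (inj₁ (refl , refl)) = toWitnessFalse κu≢κv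
      ... | yes (inj₂ (refl , refl)) = toWitnessFalse κu≢κv ∘ sym
      ... | no ¬uv                   = proper⇒Proper D κ pD (delete-edge⁻ e ¬uv)

  proper-contract : ∀ {m} (κ′ : Fin n → Fin m) → proper D (κ′ ∘ merge) ≡ proper C κ′
  proper-contract κ′ = T-injective to from
    where
    to : T (proper D (κ′ ∘ merge)) → T (proper C κ′)
    to t = Proper⇒proper C κ′ edge-ok
      where
      edge-ok : Proper C κ′
      edge-ok e with contract-edge⁺ e
      ... | a≢b , i , j , eG , refl , refl =
        proper⇒Proper D (κ′ ∘ merge) t (delete-edge⁻ eG (a≢b ∘ merge-SamePair))
    from : T (proper C κ′) → T (proper D (κ′ ∘ merge))
    from t = Proper⇒proper D (κ′ ∘ merge) edge-ok
      where
      edge-ok : Proper D (κ′ ∘ merge)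
      edge-ok e with delete-edge⁺ e
      ... | eG , ¬uv = proper⇒Proper C κ′ t
        (contract-edge⁻ eG (merge-≢ eG ¬uv))

  insertAt-merge : ∀ {m} (κ′ : Fin n → Fin m) → insertAt κ′ v (κ′ u′) ≗ κ′ ∘ merge
  insertAt-merge κ′ j with punchInView v j
  ... | at-v      = trans (insertAt-lookup κ′ v _) (cong κ′ (sym merge-v))
  ... | punched a = trans (insertAt-punchIn κ′ v _ a) (cong κ′ (sym (merge-punchIn a)))

  insertAt-u : ∀ {m} (κ′ : Fin n → Fin m) c → insertAt κ′ v c u ≡ κ′ u′
  insertAt-u κ′ c = trans (cong (insertAt κ′ v c) (sym punchIn-u′)) (insertAt-punchIn κ′ v c u′)

  -- colourings of G \ e that agree on u and v are the colourings of G / e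
  proper-insertAt : ∀ {m} (κ′ : Fin n → Fin m) c →
    proper D (insertAt κ′ v c) ∧ (insertAt κ′ v c u ==ᶠ insertAt κ′ v c v) ≡ proper C κ′ ∧ (κ′ u′ ==ᶠ c)
  proper-insertAt κ′ c rewrite insertAt-u κ′ c | insertAt-lookup κ′ v c with κ′ u′ ≟ᶠ c
  ... | yes refl = cong (_∧ true) (trans (proper-cong D D (λ _ _ → refl) (insertAt-merge κ′)) (proper-contract κ′))
  ... | no _     = trans (BoolP.∧-zeroʳ _) (sym (BoolP.∧-zeroʳ _))

  ∑-monochromatic : ∀ m → ∑ (allFuns (suc n) m) (λ κ → 𝟙 (proper D κ ∧ (κ u ==ᶠ κ v))) ≡ χ C m
  ∑-monochromatic m = begin
    ∑ (allFuns (suc n) m) (λ κ → 𝟙 (proper D κ ∧ (κ u ==ᶠ κ v)))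
      ≡⟨ ∑-allFuns-insertAt n m v _ (λ κ≗κ′ → cong 𝟙 (cong₂ _∧_ (proper-cong D D (λ _ _ → refl) κ≗κ′)
                                                     (cong₂ _==ᶠ_ (κ≗κ′ u) (κ≗κ′ v)))) ⟩
    ∑ cs (λ c → ∑ κs (λ κ′ → 𝟙 (proper D (insertAt κ′ v c) ∧ (insertAt κ′ v c u ==ᶠ insertAt κ′ v c v))))
      ≡⟨ ∑-cong cs (λ c → ∑-cong κs (λ κ′ → cong 𝟙 (proper-insertAt κ′ c))) ⟩
    ∑ cs (λ c → ∑ κs (λ κ′ → 𝟙 (proper C κ′ ∧ (κ′ u′ ==ᶠ c))))
      ≡⟨ ∑-comm cs κs _ ⟩
    ∑ κs (λ κ′ → ∑ cs (λ c → 𝟙 (proper C κ′ ∧ (κ′ u′ ==ᶠ c))))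
      ≡⟨ ∑-cong κs (λ κ′ → ∑-allFin-∧== (proper C κ′) (κ′ u′)) ⟩
    χ C m ∎
    where
    open ≡-Reasoning
    cs : List (Fin m)
    cs = allFin m
    κs : List (Fin n → Fin m)
    κs = allFuns n m

  χ-delete : ∀ m → χ D m ≡ χ G m ℕ.+ χ C m
  χ-delete m = begin
    χ D m
      ≡⟨ ∑-cong κs (λ κ → 𝟙-split (proper D κ) (κ u ==ᶠ κ v)) ⟩
    ∑ κs (λ κ → 𝟙 (proper D κ ∧ not (κ u ==ᶠ κ v)) ℕ.+ 𝟙 (proper D κ ∧ (κ u ==ᶠ κ v)))
      ≡⟨ ∑-distrib-+ κs (λ κ → 𝟙 (proper D κ ∧ not (κ u ==ᶠ κ v))) _ ⟩
    ∑ κs (λ κ → 𝟙 (proper D κ ∧ not (κ u ==ᶠ κ v))) ℕ.+ ∑ κs (λ κ → 𝟙 (proper D κ ∧ (κ u ==ᶠ κ v)))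
      ≡⟨ cong₂ ℕ._+_ (∑-cong κs (λ κ → cong 𝟙 (sym (proper-delete κ)))) (∑-monochromatic m) ⟩
    χ G m ℕ.+ χ C m ∎
    where
    open ≡-Reasoning
    κs : List (Fin (suc n) → Fin m)
    κs = allFuns (suc n) m

-- Summing the monomial coefficients of X_G over all exponent lists

length-filterᵇ : ∀ {A : Set} (p : A → Bool) xs → length (filterᵇ p xs) ≡ ∑ xs (𝟙 ∘ p)
length-filterᵇ p [] = refl
length-filterᵇ p (x ∷ xs) with p x
... | true  = cong suc (length-filterᵇ p xs)
... | false = length-filterᵇ p xs

𝟙-∧ : ∀ a b → 𝟙 (a ∧ b) ≡ 𝟙 a ℕ.* 𝟙 b
𝟙-∧ false b = refl
𝟙-∧ true  b = sym (ℕP.+-identityʳ (𝟙 b))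

colourCount≤ : ∀ {n m} (κ : Fin n → Fin m) c → colourCount κ c ≤ n
colourCount≤ {n} κ c = subst (colourCount κ c ≤_) (ListP.length-tabulate (λ i → i))
  (ListP.length-filter (λ i → T? (κ i ==ᶠ c)) (allFin n))

boundedLists : ℕ → ℕ → List (List ℕ)
boundedLists B zero    = [ [] ]
boundedLists B (suc m) = concatMap (λ a → map (a ∷_) (boundedLists B m)) (upTo (suc B))

boundedLists-length : ∀ B m → All (λ α → length α ≡ m) (boundedLists B m)
boundedLists-length B zero    = refl ∷ []
boundedLists-length B (suc m) = AllP.concat⁺ (AllP.map⁺ (All.universal
  (λ a → AllP.map⁺ (All.map (cong suc) (boundedLists-length B m))) (upTo (suc B))))

matches : ∀ {m} → (Fin m → ℕ) → List ℕ → Bool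
matches {zero}  t []      = true
matches {zero}  t (_ ∷ _) = false
matches {suc m} t []      = false
matches {suc m} t (a ∷ α) = (t zero ≡ᵇ a) ∧ matches (t ∘ suc) α

all-allFin-suc : ∀ {m} (p : Fin (suc m) → Bool) → all p (allFin (suc m)) ≡ p zero ∧ all (p ∘ suc) (allFin m)
all-allFin-suc {m} p = cong (p zero ∧_) (cong and (trans (ListP.map-tabulate suc p)
  (sym (ListP.map-tabulate (λ c → c) (p ∘ suc)))))

hasType≡matches : ∀ {n} α (κ : Fin n → Fin (length α)) → hasType α κ ≡ matches (colourCount κ) α
hasType≡matches α κ = go α (colourCount κ)
  where
  go : ∀ α (t : Fin (length α) → ℕ) → all (λ c → t c ≡ᵇ lookup α c) (allFin (length α)) ≡ matches t α
  go []      t = refl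
  go (a ∷ α) t =
    trans (all-allFin-suc (λ c → t c ≡ᵇ lookup (a ∷ α) c)) (cong ((t zero ≡ᵇ a) ∧_) (go α (t ∘ suc)))

∑-matches : ∀ B m (t : Fin m → ℕ) → (∀ c → t c ≤ B) → ∑ (boundedLists B m) (𝟙 ∘ matches t) ≡ 1
∑-matches B zero    t t≤B = refl
∑-matches B (suc m) t t≤B = begin
  ∑ (boundedLists B (suc m)) (𝟙 ∘ matches t)
    ≡⟨ ∑-concatMap (upTo (suc B)) (λ a → map (a ∷_) αs) (𝟙 ∘ matches t) ⟩
  ∑ (upTo (suc B)) (λ a → ∑ (map (a ∷_) αs) (𝟙 ∘ matches t))
    ≡⟨ ∑-cong (upTo (suc B)) (λ a → ∑-map αs (a ∷_) (𝟙 ∘ matches t)) ⟩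
  ∑ (upTo (suc B)) (λ a → ∑ αs (λ α → 𝟙 ((t zero ≡ᵇ a) ∧ matches (t ∘ suc) α)))
    ≡⟨ ∑-cong (upTo (suc B)) (λ a → trans (∑-cong αs (λ α → 𝟙-∧ (t zero ≡ᵇ a) _))
                                          (∑-distribˡ αs (𝟙 (t zero ≡ᵇ a)) (𝟙 ∘ matches (t ∘ suc)))) ⟩
  ∑ (upTo (suc B)) (λ a → 𝟙 (t zero ≡ᵇ a) ℕ.* ∑ αs (𝟙 ∘ matches (t ∘ suc)))
    ≡⟨ ∑-cong (upTo (suc B)) (λ a → cong (𝟙 (t zero ≡ᵇ a) ℕ.*_) (∑-matches B m (t ∘ suc) (t≤B ∘ suc))) ⟩
  ∑ (upTo (suc B)) (λ a → 𝟙 (t zero ≡ᵇ a) ℕ.* 1)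
    ≡⟨ ∑-cong (upTo (suc B)) (λ a → ℕP.*-identityʳ _) ⟩
  ∑ (upTo (suc B)) (λ a → 𝟙 (t zero ≡ᵇ a))
    ≡⟨ ∑-upTo-ifᵇ (s≤s (t≤B zero)) (λ _ → 1) ⟩
  1 ∎
  where
  open ≡-Reasoning
  αs : List (List ℕ)
  αs = boundedLists B m

monoCoeff≡∑ : ∀ {n} (H : Graph n) α {m} → length α ≡ m →
              monoCoeff H α ≡ ∑ (allFuns n m) (λ κ → 𝟙 (proper H κ ∧ matches (colourCount κ) α))
monoCoeff≡∑ {n} H α refl = trans (length-filterᵇ _ (allFuns n (length α)))
  (∑-cong (allFuns n (length α)) (λ κ → cong (λ b → 𝟙 (proper H κ ∧ b)) (hasType≡matches α κ)))

-- X_G(1, …, 1) with m ones counts the proper m-colourings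
∑-monoCoeff : ∀ {n} (H : Graph n) {B} m → n ≤ B → ∑ (boundedLists B m) (monoCoeff H) ≡ χ H m
∑-monoCoeff {n} H {B} m n≤B = begin
  ∑ αs (monoCoeff H)
    ≡⟨ ∑-congᴬ αs (All.map (monoCoeff≡∑ H _) (boundedLists-length B m)) ⟩
  ∑ αs (λ α → ∑ κs (λ κ → 𝟙 (proper H κ ∧ matches (colourCount κ) α)))
    ≡⟨ ∑-comm αs κs _ ⟩
  ∑ κs (λ κ → ∑ αs (λ α → 𝟙 (proper H κ ∧ matches (colourCount κ) α)))
    ≡⟨ ∑-cong κs (λ κ → trans (∑-cong αs (λ α → 𝟙-∧ (proper H κ) _))
                              (∑-distribˡ αs (𝟙 (proper H κ)) (𝟙 ∘ matches (colourCount κ)))) ⟩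
  ∑ κs (λ κ → 𝟙 (proper H κ) ℕ.* ∑ αs (𝟙 ∘ matches (colourCount κ)))
    ≡⟨ ∑-cong κs (λ κ → cong (𝟙 (proper H κ) ℕ.*_)
         (∑-matches B m (colourCount κ) (λ c → ℕP.≤-trans (colourCount≤ κ c) n≤B))) ⟩
  ∑ κs (λ κ → 𝟙 (proper H κ) ℕ.* 1)
    ≡⟨ ∑-cong κs (λ κ → ℕP.*-identityʳ _) ⟩
  χ H m ∎
  where
  open ≡-Reasoning
  αs : List (List ℕ)
  αs = boundedLists B m
  κs : List (Fin n → Fin m)
  κs = allFuns n m

-- Colourings of path forests

dropFirst : ∀ {n} → Graph (suc n) → Graph n
dropFirst H i j = H (suc i) (suc j)

isEdge-dropFirst : ∀ {n} (H : Graph (suc n)) i j → isEdge H (suc i) (suc j) ≡ isEdge (dropFirst H) i j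
isEdge-dropFirst H i j = cong (λ b → not b ∧ (H (suc i) (suc j) ∨ H (suc j) (suc i))) (==ᶠ-suc i j)

module _ {n m} (H : Graph (suc n)) (c : Fin m) (κ : Fin n → Fin m) where

  Proper-∷⁺ : Proper H (c ∷ᶠ κ) → Proper (dropFirst H) κ
  Proper-∷⁺ P {i} {j} e = P (subst T (sym (isEdge-dropFirst H i j)) e)

  Proper-∷⁻ : Proper (dropFirst H) κ → (∀ {j} → T (isEdge H zero (suc j)) → c ≢ κ j) → Proper H (c ∷ᶠ κ)
  Proper-∷⁻ P c-ok {zero}  {zero}  e = ⊥-elim (isEdge-irrefl H {zero} e refl)
  Proper-∷⁻ P c-ok {zero}  {suc j} e = c-ok {j} e
  Proper-∷⁻ P c-ok {suc i} {zero}  e = c-ok {i} (subst T (isEdge-sym H (suc i) zero) e) ∘ sym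
  Proper-∷⁻ P c-ok {suc i} {suc j} e = P (subst T (isEdge-dropFirst H i j) e)

  proper-∷-isolated : (∀ j → ¬ T (isEdge H zero j)) → proper H (c ∷ᶠ κ) ≡ proper (dropFirst H) κ
  proper-∷-isolated isolated = T-injective
    (Proper⇒proper (dropFirst H) κ ∘ Proper-∷⁺ ∘ proper⇒Proper H (c ∷ᶠ κ))
    (λ t → Proper⇒proper H (c ∷ᶠ κ)
             (Proper-∷⁻ (proper⇒Proper (dropFirst H) κ t) (λ {j} → ⊥-elim ∘ isolated (suc j))))

proper-∷-leaf : ∀ {n m} (H : Graph (suc (suc n))) (c : Fin m) κ →
                (∀ {j} → T (isEdge H zero j) → j ≡ suc zero) → T (isEdge H zero (suc zero)) →
                proper H (c ∷ᶠ κ) ≡ not (c ==ᶠ κ zero) ∧ proper (dropFirst H) κ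
proper-∷-leaf H c κ leaf e₀₁ = T-injective
  (λ t → let P = proper⇒Proper H (c ∷ᶠ κ) t in
    T-∧⁻ (fromWitnessFalse {a? = c ≟ᶠ κ zero} (P {zero} {suc zero} e₀₁))
         (Proper⇒proper (dropFirst H) κ (Proper-∷⁺ H c κ P)))
  (λ t → let (c≢κ₀ , t′) = T-∧⁺ {not (c ==ᶠ κ zero)} t in
    Proper⇒proper H (c ∷ᶠ κ) (Proper-∷⁻ H c κ (proper⇒Proper (dropFirst H) κ t′)
      (λ e → subst (λ j → c ≢ κ j) (sym (FinP.suc-injective (leaf e))) (toWitnessFalse c≢κ₀))))

∑-allFin-const : ∀ m x → ∑ (allFin m) (λ _ → x) ≡ m ℕ.* x
∑-allFin-const m x = begin
  ∑ (allFin m) (λ _ → x)        ≡⟨ ∑-cong (allFin m) (λ _ → ℕP.*-identityˡ x) ⟨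
  ∑ (allFin m) (λ _ → 1 ℕ.* x)  ≡⟨ ∑-distribʳ (allFin m) x (λ _ → 1) ⟩
  ∑ (allFin m) (λ _ → 1) ℕ.* x  ≡⟨ cong (ℕ._* x) (∑-allFin-1 m) ⟩
  m ℕ.* x                       ∎
  where open ≡-Reasoning

χ-isolated : ∀ {n} (H : Graph (suc n)) → (∀ j → ¬ T (isEdge H zero j)) → ∀ m → χ H m ≡ m ℕ.* χ (dropFirst H) m
χ-isolated {n} H isolated m = begin
  χ H m
    ≡⟨ ∑-allFuns-∷ n m (𝟙 ∘ proper H) ⟩
  ∑ (allFin m) (λ c → ∑ (allFuns n m) (λ κ → 𝟙 (proper H (c ∷ᶠ κ))))
    ≡⟨ ∑-cong (allFin m) (λ c → ∑-cong (allFuns n m) (λ κ → cong 𝟙 (proper-∷-isolated H c κ isolated))) ⟩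
  ∑ (allFin m) (λ _ → χ (dropFirst H) m)
    ≡⟨ ∑-allFin-const m _ ⟩
  m ℕ.* χ (dropFirst H) m ∎
  where open ≡-Reasoning

χ-leaf : ∀ {n} (H : Graph (suc (suc n))) → (∀ {j} → T (isEdge H zero j) → j ≡ suc zero) →
         T (isEdge H zero (suc zero)) → ∀ m → χ H (suc m) ≡ m ℕ.* χ (dropFirst H) (suc m)
χ-leaf {n} H leaf e₀₁ m = begin
  χ H (suc m)
    ≡⟨ ∑-allFuns-∷ (suc n) (suc m) (𝟙 ∘ proper H) ⟩
  ∑ cs (λ c → ∑ κs (λ κ → 𝟙 (proper H (c ∷ᶠ κ))))
    ≡⟨ ∑-cong cs (λ c → ∑-cong κs (λ κ →
         trans (cong 𝟙 (proper-∷-leaf H c κ leaf e₀₁)) (𝟙-∧ (not (c ==ᶠ κ zero)) _))) ⟩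
  ∑ cs (λ c → ∑ κs (λ κ → 𝟙 (not (c ==ᶠ κ zero)) ℕ.* 𝟙 (proper (dropFirst H) κ)))
    ≡⟨ ∑-comm cs κs _ ⟩
  ∑ κs (λ κ → ∑ cs (λ c → 𝟙 (not (c ==ᶠ κ zero)) ℕ.* 𝟙 (proper (dropFirst H) κ)))
    ≡⟨ ∑-cong κs (λ κ → trans (∑-distribʳ cs _ (λ c → 𝟙 (not (c ==ᶠ κ zero))))
                               (cong (ℕ._* 𝟙 (proper (dropFirst H) κ)) (∑-allFin-≢ (κ zero)))) ⟩
  ∑ κs (λ κ → m ℕ.* 𝟙 (proper (dropFirst H) κ))
    ≡⟨ ∑-distribˡ κs m _ ⟩
  m ℕ.* χ (dropFirst H) (suc m) ∎
  where
  open ≡-Reasoning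
  cs : List (Fin (suc m))
  cs = allFin (suc m)
  κs : List (Fin (suc n) → Fin (suc m))
  κs = allFuns (suc n) (suc m)

partialSums-suc : ∀ acc xs → partialSums (suc acc) xs ≡ map suc (partialSums acc xs)
partialSums-suc acc []       = refl
partialSums-suc acc (x ∷ xs) = cong (suc (acc ℕ.+ x) ∷_) (partialSums-suc (acc ℕ.+ x) xs)

any-map : ∀ {A B : Set} (p : B → Bool) (f : A → B) xs → any p (map f xs) ≡ any (p ∘ f) xs
any-map p f xs = cong or (sym (ListP.map-∘ xs))

any-false : ∀ {A : Set} (xs : List A) → any (λ _ → false) xs ≡ false
any-false []       = refl
any-false (x ∷ xs) = any-false xs

pathsGraph-0 : ∀ r i j → pathsGraph (0 ∷ r) i j ≡ pathsGraph r i j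
pathsGraph-0 r i j with toℕ j
... | zero  = refl
... | suc _ = refl

pathsGraph-dropFirst : ∀ k r i j → dropFirst (pathsGraph (suc k ∷ r)) i j ≡ pathsGraph (k ∷ r) i j
pathsGraph-dropFirst k r i j = cong (λ b → (toℕ j ≡ᵇ suc (toℕ i)) ∧ not ((k ≡ᵇ toℕ j) ∨ b))
  (trans (cong (any (λ s → s ≡ᵇ suc (toℕ j))) (partialSums-suc k r))
         (any-map (λ s → s ≡ᵇ suc (toℕ j)) ℕ.suc (partialSums k r)))

pathsGraph-isolated : ∀ r j → ¬ T (isEdge (pathsGraph (1 ∷ r)) zero j)
pathsGraph-isolated r j e with T-∨⁺ {pathsGraph (1 ∷ r) zero j} (proj₂ (T-∧⁺ {not (zero ==ᶠ j)} e))
... | inj₁ t = no-successor (toℕ j) t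
  where
  no-successor : ∀ t → ¬ T ((t ≡ᵇ 1) ∧ not ((1 ≡ᵇ t) ∨ any (λ s → s ≡ᵇ t) (partialSums 1 r)))
  no-successor (suc zero) ()

pathsGraph-leaf : ∀ k r {j} → T (isEdge (pathsGraph (suc (suc k) ∷ r)) zero j) → j ≡ suc zero
pathsGraph-leaf k r {j} e with T-∨⁺ {pathsGraph (suc (suc k) ∷ r) zero j} (proj₂ (T-∧⁺ {not (zero ==ᶠ j)} e))
... | inj₁ t = FinP.toℕ-injective (ℕP.≡ᵇ⇒≡ (toℕ j) 1 (proj₁ (T-∧⁺ {toℕ j ≡ᵇ 1} t)))

pathsGraph-edge₀₁ : ∀ k r → T (isEdge (pathsGraph (suc (suc k) ∷ r)) zero (suc zero))
pathsGraph-edge₀₁ k r = subst (λ b → T (not b ∨ false)) (sym no-cut-at-1) _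
  where
  no-cut-at-1 : any (λ s → s ≡ᵇ 1) (partialSums (suc (suc k)) r) ≡ false
  no-cut-at-1 = begin
    any (λ s → s ≡ᵇ 1) (partialSums (suc (suc k)) r)
      ≡⟨ cong (any (λ s → s ≡ᵇ 1)) (trans (partialSums-suc (suc k) r) (cong (map suc) (partialSums-suc k r))) ⟩
    any (λ s → s ≡ᵇ 1) (map suc (map suc (partialSums k r)))
      ≡⟨ trans (any-map (λ s → s ≡ᵇ 1) ℕ.suc (map ℕ.suc (partialSums k r)))
               (any-map (λ s → suc s ≡ᵇ 1) ℕ.suc (partialSums k r)) ⟩
    any (λ _ → false) (partialSums k r)
      ≡⟨ any-false (partialSums k r) ⟩
    false ∎
    where open ≡-Reasoning

-- the number of proper (m + 1)-colourings of a path on k vertices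
pathBlock : ℕ → ℕ → ℕ
pathBlock m zero    = 1
pathBlock m (suc k) = suc m ℕ.* m ℕ.^ k

χ-pathsGraph-∷ : ∀ m k r → χ (pathsGraph (k ∷ r)) (suc m) ≡ pathBlock m k ℕ.* χ (pathsGraph r) (suc m)
χ-pathsGraph-∷ m zero r = trans (χ-cong (pathsGraph (0 ∷ r)) (pathsGraph r) (pathsGraph-0 r) (suc m)) (sym (ℕP.+-identityʳ _))
χ-pathsGraph-∷ m (suc zero) r = begin
  χ (pathsGraph (1 ∷ r)) (suc m)
    ≡⟨ χ-isolated (pathsGraph (1 ∷ r)) (pathsGraph-isolated r) (suc m) ⟩
  suc m ℕ.* χ (dropFirst (pathsGraph (1 ∷ r))) (suc m)
    ≡⟨ cong (suc m ℕ.*_) (χ-cong (dropFirst (pathsGraph (1 ∷ r))) (pathsGraph (0 ∷ r)) (pathsGraph-dropFirst 0 r) (suc m)) ⟩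
  suc m ℕ.* χ (pathsGraph (0 ∷ r)) (suc m)
    ≡⟨ cong (suc m ℕ.*_) (χ-pathsGraph-∷ m 0 r) ⟩
  suc m ℕ.* (1 ℕ.* χ (pathsGraph r) (suc m))
    ≡⟨ ℕP.*-assoc (suc m) 1 _ ⟨
  suc m ℕ.* 1 ℕ.* χ (pathsGraph r) (suc m) ∎
  where open ≡-Reasoning
χ-pathsGraph-∷ m (suc (suc k)) r = begin
  χ (pathsGraph (suc (suc k) ∷ r)) (suc m)
    ≡⟨ χ-leaf (pathsGraph (suc (suc k) ∷ r)) (pathsGraph-leaf k r) (pathsGraph-edge₀₁ k r) m ⟩
  m ℕ.* χ (dropFirst (pathsGraph (suc (suc k) ∷ r))) (suc m)
    ≡⟨ cong (m ℕ.*_) (χ-cong (dropFirst (pathsGraph (suc (suc k) ∷ r))) (pathsGraph (suc k ∷ r))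
         (pathsGraph-dropFirst (suc k) r) (suc m)) ⟩
  m ℕ.* χ (pathsGraph (suc k ∷ r)) (suc m)
    ≡⟨ cong (m ℕ.*_) (χ-pathsGraph-∷ m (suc k) r) ⟩
  m ℕ.* (suc m ℕ.* m ℕ.^ k ℕ.* χ (pathsGraph r) (suc m))
    ≡⟨ solve 4 (λ m s p x → m :* (s :* p :* x) := s :* (m :* p) :* x) refl m (suc m) (m ℕ.^ k) _ ⟩
  suc m ℕ.* (m ℕ.* m ℕ.^ k) ℕ.* χ (pathsGraph r) (suc m) ∎
  where
  open ≡-Reasoning
  open ℕ-Solver

IsPartitionOf : ℕ → List ℕ → Set
IsPartitionOf n λs = sum λs ≡ n × All (1 ≤_) λs

partsBounded-IsPartitionOf : ∀ f n k → All (IsPartitionOf n) (partsBounded f n k)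
partsBounded-IsPartitionOf f       zero    k = (refl , []) ∷ []
partsBounded-IsPartitionOf zero    (suc n) k = []
partsBounded-IsPartitionOf (suc f) (suc n) k = AllP.concat⁺ (AllP.map⁺ (All.map extend firstParts))
  where
  firstParts : All (λ p → 1 ≤ p × p ≤ suc n) (map suc (upTo (k ⊓ suc n)))
  firstParts = AllP.map⁺ (All.map (λ i< → s≤s z≤n , ℕP.≤-trans i< (ℕP.m⊓n≤n k (suc n))) (AllP.all-upTo (k ⊓ suc n)))
  extend : ∀ {p} → 1 ≤ p × p ≤ suc n → All (IsPartitionOf (suc n)) (map (p ∷_) (partsBounded f (suc n ∸ p) p))
  extend {p} (1≤p , p≤) = AllP.map⁺ (All.map
    (λ (Σλs≡ , pos) → trans (cong (p ℕ.+_) Σλs≡) (ℕP.m+[n∸m]≡n p≤) , 1≤p ∷ pos)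
    (partsBounded-IsPartitionOf f (suc n ∸ p) p))

partitions-IsPartitionOf : ∀ n → All (IsPartitionOf n) (partitions n)
partitions-IsPartitionOf n = partsBounded-IsPartitionOf n n n

length≤sum : ∀ {λs} → All (1 ≤_) λs → length λs ≤ sum λs
length≤sum []        = z≤n
length≤sum (p ∷ pos) = ℕP.+-mono-≤ p (length≤sum pos)

IsPartitionOf-length : ∀ {n λs} → IsPartitionOf n λs → length λs ≤ n
IsPartitionOf-length (refl , pos) = length≤sum pos

-- The chromatic polynomial in terms of the tree polynomial

toℚ-^ : ∀ a k → toℚ (a ℕ.^ k) ≡ toℚ a ^ k
toℚ-^ a zero    = refl
toℚ-^ a (suc k) = trans (toℚ-* a (a ℕ.^ k)) (cong (toℚ a *_) (toℚ-^ a k))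

toℚ[1+m]-1≡toℚ[m] : ∀ m → toℚ (suc m) - 1ℚ ≡ toℚ m
toℚ[1+m]-1≡toℚ[m] m = trans (cong (_- 1ℚ) (toℚ-+ 1 m)) (solve 1 (λ y → (con 1ℚ :+ y) :- con 1ℚ := y) refl (toℚ m))
  where open ℚ-Solver

-- the chromatic polynomial of a forest of j paths on N vertices
pathForestχ : ℕ → ℕ → ℚ → ℚ
pathForestχ N j x = x ^ j * (x - 1ℚ) ^ (N ∸ j)

-- (x - 1)^N D(x / (x - 1)); the chromatic polynomial when D is the tree polynomial
homogenize : ℕ → (ℕ → ℚ) → ℚ → ℚ
homogenize N D x = Σℚ (upTo (suc N)) (λ j → D j * pathForestχ N j x)

χ-pathsGraph : ∀ m λs → All (1 ≤_) λs →
               toℚ (χ (pathsGraph λs) (suc m)) ≡ toℚ (suc m) ^ length λs * toℚ m ^ (sum λs ∸ length λs)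
χ-pathsGraph m []          []        = refl
χ-pathsGraph m (suc k ∷ r) (_ ∷ pos) = begin
  toℚ (χ (pathsGraph (suc k ∷ r)) (suc m))
    ≡⟨ cong toℚ (χ-pathsGraph-∷ m (suc k) r) ⟩
  toℚ (suc m ℕ.* m ℕ.^ k ℕ.* χ (pathsGraph r) (suc m))
    ≡⟨ trans (toℚ-* (suc m ℕ.* m ℕ.^ k) _)
             (cong₂ _*_ (trans (toℚ-* (suc m) (m ℕ.^ k)) (cong (x *_) (toℚ-^ m k))) (χ-pathsGraph m r pos)) ⟩
  x * y ^ k * (x ^ length r * y ^ (sum r ∸ length r))
    ≡⟨ solve 4 (λ x a b c → x :* a :* (b :* c) := x :* b :* (a :* c)) refl x (y ^ k) (x ^ length r) (y ^ (sum r ∸ length r)) ⟩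
  x * x ^ length r * (y ^ k * y ^ (sum r ∸ length r))
    ≡⟨ cong (x * x ^ length r *_) (^-homo-* y k (sum r ∸ length r)) ⟨
  x * x ^ length r * y ^ (k ℕ.+ (sum r ∸ length r))
    ≡⟨ cong (λ e → x * x ^ length r * y ^ e) (ℕP.+-∸-assoc k (length≤sum pos)) ⟨
  x * x ^ length r * y ^ (k ℕ.+ sum r ∸ length r) ∎
  where
  open ≡-Reasoning
  open ℚ-Solver
  x : ℚ
  x = toℚ (suc m)
  y : ℚ
  y = toℚ m

χ≡homogenize : ∀ {N} (H : Graph N) (a : List ℕ → ℚ) → IsPathExpansion H a →
               ∀ m → toℚ (χ H (suc m)) ≡ homogenize N (treePoly N a) (toℚ (suc m))
χ≡homogenize {N} H a expansion m = begin
  toℚ (χ H (suc m))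
    ≡⟨ cong toℚ (∑-monoCoeff H (suc m) ℕP.≤-refl) ⟨
  toℚ (∑ αs (monoCoeff H))
    ≡⟨ toℚ-∑ αs (monoCoeff H) ⟩
  Σℚ αs (toℚ ∘ monoCoeff H)
    ≡⟨ ℚ∑.∑-cong αs expansion ⟩
  Σℚ αs (λ α → Σℚ λss (λ λs → a λs * toℚ (monoCoeff (pathsGraph λs) α)))
    ≡⟨ ℚ∑.∑-comm αs λss (λ α λs → a λs * toℚ (monoCoeff (pathsGraph λs) α)) ⟩
  Σℚ λss (λ λs → Σℚ αs (λ α → a λs * toℚ (monoCoeff (pathsGraph λs) α)))
    ≡⟨ ℚ∑.∑-cong λss (λ λs → ℚ∑.∑-distribˡ αs (a λs) (toℚ ∘ monoCoeff (pathsGraph λs))) ⟩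
  Σℚ λss (λ λs → a λs * Σℚ αs (toℚ ∘ monoCoeff (pathsGraph λs)))
    ≡⟨ ℚ∑.∑-congᴬ λss (All.map (cong (a _ *_) ∘ pathsGraph-term) (partitions-IsPartitionOf N)) ⟩
  Σℚ λss (λ λs → a λs * pathForestχ N (length λs) x)
    ≡⟨ ℚ∑.∑-groupBy length λss (All.map (s≤s ∘ IsPartitionOf-length) (partitions-IsPartitionOf N)) a _ ⟩
  homogenize N (treePoly N a) x ∎
  where
  open ≡-Reasoning
  αs : List (List ℕ)
  αs = boundedLists N (suc m)
  λss : List (List ℕ)
  λss = partitions N
  x : ℚ
  x = toℚ (suc m)
  pathsGraph-term : ∀ {λs} → IsPartitionOf N λs →
                    Σℚ αs (toℚ ∘ monoCoeff (pathsGraph λs)) ≡ pathForestχ N (length λs) x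
  pathsGraph-term {λs} (refl , pos) = begin
    Σℚ αs (toℚ ∘ monoCoeff (pathsGraph λs))
      ≡⟨ toℚ-∑ αs (monoCoeff (pathsGraph λs)) ⟨
    toℚ (∑ αs (monoCoeff (pathsGraph λs)))
      ≡⟨ cong toℚ (∑-monoCoeff (pathsGraph λs) (suc m) ℕP.≤-refl) ⟩
    toℚ (χ (pathsGraph λs) (suc m))
      ≡⟨ χ-pathsGraph m λs pos ⟩
    x ^ length λs * toℚ m ^ (sum λs ∸ length λs)
      ≡⟨ cong (λ y → x ^ length λs * y ^ (sum λs ∸ length λs)) (toℚ[1+m]-1≡toℚ[m] m) ⟨
    x ^ length λs * (x - 1ℚ) ^ (sum λs ∸ length λs) ∎

Σℚ-distrib-− : ∀ {A : Set} xs (f g : A → ℚ) → Σℚ xs (λ x → f x - g x) ≡ Σℚ xs f - Σℚ xs g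
Σℚ-distrib-− []       f g = refl
Σℚ-distrib-− (x ∷ xs) f g = trans (cong (f x - g x +_) (Σℚ-distrib-− xs f g))
  (solve 4 (λ a b c d → (a :- b) :+ (c :- d) := (a :+ c) :- (b :+ d)) refl (f x) (g x) (Σℚ xs f) (Σℚ xs g))
  where open ℚ-Solver

1ℚ^n≡1ℚ : ∀ k → 1ℚ ^ k ≡ 1ℚ
1ℚ^n≡1ℚ zero    = refl
1ℚ^n≡1ℚ (suc k) = trans (ℚP.*-identityˡ (1ℚ ^ k)) (1ℚ^n≡1ℚ k)

module _ (x : ℚ) where

  homogenize-cong : ∀ N {D D′ : ℕ → ℚ} → (∀ j → D j ≡ D′ j) → homogenize N D x ≡ homogenize N D′ x
  homogenize-cong N D≡D′ = ℚ∑.∑-cong (upTo (suc N)) (λ j → cong (_* _) (D≡D′ j))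

  homogenize-⊖ : ∀ N D D′ → homogenize N (D ⊖ D′) x ≡ homogenize N D x - homogenize N D′ x
  homogenize-⊖ N D D′ = trans
    (ℚ∑.∑-cong (upTo (suc N)) (λ j →
      solve 3 (λ a b c → (a :- b) :* c := a :* c :- b :* c) refl (D j) (D′ j) (pathForestχ N j x)))
    (Σℚ-distrib-− (upTo (suc N)) (λ j → D j * pathForestχ N j x) (λ j → D′ j * pathForestχ N j x))
    where open ℚ-Solver

  homogenize-suc-head : ∀ N D → homogenize (suc N) D x ≡ D 0 * (x - 1ℚ) ^ suc N + x * homogenize N (D ∘ suc) x
  homogenize-suc-head N D = trans (ℚ∑.∑-upTo-suc (suc N) (λ j → D j * pathForestχ (suc N) j x)) (cong₂ _+_
    (cong (D 0 *_) (ℚP.*-identityˡ _))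
    (trans (ℚ∑.∑-cong (upTo (suc N)) (λ j → solve 4 (λ d x p q → d :* (x :* p :* q) := x :* (d :* (p :* q)))
                                                      refl (D (suc j)) x (x ^ j) ((x - 1ℚ) ^ (N ∸ j))))
           (ℚ∑.∑-distribˡ (upTo (suc N)) x _)))
    where open ℚ-Solver

  homogenize-suc-last : ∀ N D → homogenize (suc N) D x ≡ (x - 1ℚ) * homogenize N D x + D (suc N) * x ^ suc N
  homogenize-suc-last N D = trans (ℚ∑.∑-upTo-∷ʳ (suc N) (λ j → D j * pathForestχ (suc N) j x)) (cong₂ _+_
    (trans (ℚ∑.∑-congᴬ (upTo (suc N)) (All.map shift-exponent (AllP.all-upTo (suc N))))
           (ℚ∑.∑-distribˡ (upTo (suc N)) (x - 1ℚ) _))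
    (trans (cong (λ e → D (suc N) * (x ^ suc N * (x - 1ℚ) ^ e)) (ℕP.n∸n≡0 N)) (cong (D (suc N) *_) (ℚP.*-identityʳ _))))
    where
    open ℚ-Solver
    shift-exponent : ∀ {j} → j < suc N → D j * pathForestχ (suc N) j x ≡ (x - 1ℚ) * (D j * pathForestχ N j x)
    shift-exponent {j} (s≤s j≤N) = trans (cong (λ e → D j * (x ^ j * (x - 1ℚ) ^ e)) (ℕP.+-∸-assoc 1 j≤N))
      (solve 4 (λ d p y q → d :* (p :* (y :* q)) := y :* (d :* (p :* q))) refl (D j) (x ^ j) (x - 1ℚ) ((x - 1ℚ) ^ (N ∸ j)))

  homogenize-xMinus1Times : ∀ N C → homogenize (suc N) (xMinus1Times C) x ≡ homogenize N C x - C (suc N) * x ^ suc N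
  homogenize-xMinus1Times N C = begin
    homogenize (suc N) (xMinus1Times C) x
      ≡⟨ homogenize-cong (suc N) xMinus1Times≡ ⟩
    homogenize (suc N) (shift ⊖ C) x
      ≡⟨ homogenize-⊖ (suc N) shift C ⟩
    homogenize (suc N) shift x - homogenize (suc N) C x
      ≡⟨ cong₂ _-_ (homogenize-suc-head N shift) (homogenize-suc-last N C) ⟩
    (0ℚ * (x - 1ℚ) ^ suc N + x * h) - ((x - 1ℚ) * h + C (suc N) * x ^ suc N)
      ≡⟨ solve 4 (λ p x h q → (con 0ℚ :* p :+ x :* h) :- ((x :- con 1ℚ) :* h :+ q) := h :- q)
               refl ((x - 1ℚ) ^ suc N) x h (C (suc N) * x ^ suc N) ⟩
    h - C (suc N) * x ^ suc N ∎
    where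
    open ≡-Reasoning
    open ℚ-Solver
    h : ℚ
    h = homogenize N C x
    shift : ℕ → ℚ
    shift zero    = 0ℚ
    shift (suc j) = C j
    xMinus1Times≡ : ∀ j → xMinus1Times C j ≡ (shift ⊖ C) j
    xMinus1Times≡ zero    = refl
    xMinus1Times≡ (suc j) = refl

homogenize-at-1 : ∀ N D → homogenize N D 1ℚ ≡ D N
homogenize-at-1 zero    D = trans (ℚP.+-identityʳ _) (ℚP.*-identityʳ (D 0))
homogenize-at-1 (suc N) D = begin
  homogenize (suc N) D 1ℚ
    ≡⟨ homogenize-suc-last 1ℚ N D ⟩
  0ℚ * homogenize N D 1ℚ + D (suc N) * 1ℚ ^ suc N
    ≡⟨ cong₂ _+_ (ℚP.*-zeroˡ (homogenize N D 1ℚ)) (cong (D (suc N) *_) (1ℚ^n≡1ℚ (suc N))) ⟩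
  0ℚ + D (suc N) * 1ℚ
    ≡⟨ trans (ℚP.+-identityˡ _) (ℚP.*-identityʳ _) ⟩
  D (suc N) ∎
  where open ≡-Reasoning

-- Polynomials vanishing at infinitely many points

p*q≡0⇒q≡0 : ∀ {p q} → p ≢ 0ℚ → p * q ≡ 0ℚ → q ≡ 0ℚ
p*q≡0⇒q≡0 {p} {q} p≢0 pq≡0 = begin
  q               ≡⟨ ℚP.*-identityˡ q ⟨
  1ℚ * q          ≡⟨ cong (_* q) (ℚP.*-inverseˡ p) ⟨
  1/ p * p * q    ≡⟨ ℚP.*-assoc (1/ p) p q ⟩
  1/ p * (p * q)  ≡⟨ cong (1/ p *_) pq≡0 ⟩
  1/ p * 0ℚ       ≡⟨ ℚP.*-zeroʳ (1/ p) ⟩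
  0ℚ              ∎
  where
  open ≡-Reasoning
  instance
    p-nonZero : ℚ.NonZero p
    p-nonZero = ℚ.≢-nonZero p≢0

p-q≡0⇒p≡q : ∀ {p q} → p - q ≡ 0ℚ → p ≡ q
p-q≡0⇒p≡q {p} {q} p-q≡0 = begin
  p            ≡⟨ solve 2 (λ p q → p := (p :- q) :+ q) refl p q ⟩
  (p - q) + q  ≡⟨ cong (_+ q) p-q≡0 ⟩
  0ℚ + q       ≡⟨ ℚP.+-identityˡ q ⟩
  q            ∎
  where
  open ≡-Reasoning
  open ℚ-Solver

-- coefficient lists, constant term first
eval : List ℚ → ℚ → ℚ
eval []      x = 0ℚ
eval (c ∷ p) x = c + x * eval p x

eval-allZero : ∀ {p} → All (_≡ 0ℚ) p → ∀ x → eval p x ≡ 0ℚ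
eval-allZero []           x = refl
eval-allZero (refl ∷ zs) x = trans (ℚP.+-identityˡ _) (trans (cong (x *_) (eval-allZero zs x)) (ℚP.*-zeroʳ x))

-- synthetic division by x - r
quot : ℚ → List ℚ → List ℚ
quot r []          = []
quot r (c ∷ [])    = []
quot r (c ∷ d ∷ p) = eval (d ∷ p) r ∷ quot r (d ∷ p)

eval-quot : ∀ r p x → eval p x ≡ (x - r) * eval (quot r p) x + eval p r
eval-quot r []          x = solve 2 (λ x r → con 0ℚ := (x :- r) :* con 0ℚ :+ con 0ℚ) refl x r
  where open ℚ-Solver
eval-quot r (c ∷ [])    x = solve 3 (λ c x r → c :+ x :* con 0ℚ := (x :- r) :* con 0ℚ :+ (c :+ r :* con 0ℚ)) refl c x r
  where open ℚ-Solver
eval-quot r (c ∷ d ∷ p) x = trans (cong (λ e → c + x * e) (eval-quot r (d ∷ p) x))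
  (solve 5 (λ c x r Q V → c :+ x :* ((x :- r) :* Q :+ V) := (x :- r) :* (V :+ x :* Q) :+ (c :+ r :* V))
         refl c x r (eval (quot r (d ∷ p)) x) (eval (d ∷ p) r))
  where open ℚ-Solver

length-quot : ∀ r c p → length (quot r (c ∷ p)) ≡ length p
length-quot r c []      = refl
length-quot r c (d ∷ p) = cong suc (length-quot r d p)

quot-allZero : ∀ r p → All (_≡ 0ℚ) (quot r p) → eval p r ≡ 0ℚ → All (_≡ 0ℚ) p
quot-allZero r []          _           _  = []
quot-allZero r (c ∷ [])    _           p≡0 = trans (sym (trans (cong (c +_) (ℚP.*-zeroʳ r)) (ℚP.+-identityʳ c))) p≡0 ∷ []
quot-allZero r (c ∷ d ∷ p) (q≡0 ∷ zs) p≡0 =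
  trans (sym (trans (cong (λ e → c + r * e) q≡0) (trans (cong (c +_) (ℚP.*-zeroʳ r)) (ℚP.+-identityʳ c)))) p≡0
  ∷ quot-allZero r (d ∷ p) zs q≡0

vanishing⇒allZero : ∀ (y : ℕ → ℚ) → Injective _≡_ _≡_ y → ∀ p → (∀ m → eval p (y m) ≡ 0ℚ) → All (_≡ 0ℚ) p
vanishing⇒allZero y y-inj p = go (length p) p ℕP.≤-refl y y-inj
  where
  go : ∀ F p → length p ≤ F → ∀ (y : ℕ → ℚ) → Injective _≡_ _≡_ y →
       (∀ m → eval p (y m) ≡ 0ℚ) → All (_≡ 0ℚ) p
  go F       []      _          y y-inj zeros = []
  go (suc F) (c ∷ q) (s≤s q≤F) y y-inj zeros =
    quot-allZero (y 0) (c ∷ q)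
      (go F (quot (y 0) (c ∷ q)) (subst (_≤ F) (sym (length-quot (y 0) c q)) q≤F)
          (y ∘ suc) (ℕP.suc-injective ∘ y-inj) quot-zeros)
      (zeros 0)
    where
    quot-zeros : ∀ m → eval (quot (y 0) (c ∷ q)) (y (suc m)) ≡ 0ℚ
    quot-zeros m = p*q≡0⇒q≡0 (λ eq → ℕP.0≢1+n (y-inj (sym (p-q≡0⇒p≡q eq)))) (begin
      (y (suc m) - y 0) * eval (quot (y 0) (c ∷ q)) (y (suc m))
        ≡⟨ ℚP.+-identityʳ _ ⟨
      (y (suc m) - y 0) * eval (quot (y 0) (c ∷ q)) (y (suc m)) + 0ℚ
        ≡⟨ cong ((y (suc m) - y 0) * eval (quot (y 0) (c ∷ q)) (y (suc m)) +_) (zeros 0) ⟨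
      (y (suc m) - y 0) * eval (quot (y 0) (c ∷ q)) (y (suc m)) + eval (c ∷ q) (y 0)
        ≡⟨ eval-quot (y 0) (c ∷ q) (y (suc m)) ⟨
      eval (c ∷ q) (y (suc m))
        ≡⟨ zeros (suc m) ⟩
      0ℚ ∎)
      where open ≡-Reasoning

_⊕_ : List ℚ → List ℚ → List ℚ
[]      ⊕ q       = q
(a ∷ p) ⊕ []      = a ∷ p
(a ∷ p) ⊕ (b ∷ q) = (a + b) ∷ (p ⊕ q)

eval-⊕ : ∀ p q x → eval (p ⊕ q) x ≡ eval p x + eval q x
eval-⊕ []      q       x = sym (ℚP.+-identityˡ _)
eval-⊕ (a ∷ p) []      x = sym (ℚP.+-identityʳ _)
eval-⊕ (a ∷ p) (b ∷ q) x = trans (cong (λ e → a + b + x * e) (eval-⊕ p q x))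
  (solve 5 (λ a b x P Q → a :+ b :+ x :* (P :+ Q) := (a :+ x :* P) :+ (b :+ x :* Q)) refl a b x (eval p x) (eval q x))
  where open ℚ-Solver

eval-map-neg : ∀ p x → eval (map -_ p) x ≡ - eval p x
eval-map-neg []      x = refl
eval-map-neg (a ∷ p) x = trans (cong (λ e → - a + x * e) (eval-map-neg p x))
  (solve 3 (λ a x P → :- a :+ x :* (:- P) := :- (a :+ x :* P)) refl a x (eval p x))
  where open ℚ-Solver

timesXMinus1 : List ℚ → List ℚ
timesXMinus1 p = (0ℚ ∷ p) ⊕ map -_ p

eval-timesXMinus1 : ∀ p x → eval (timesXMinus1 p) x ≡ (x - 1ℚ) * eval p x
eval-timesXMinus1 p x = trans (eval-⊕ (0ℚ ∷ p) (map -_ p) x) (trans (cong (0ℚ + x * eval p x +_) (eval-map-neg p x))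
  (solve 2 (λ x P → con 0ℚ :+ x :* P :+ :- P := (x :- con 1ℚ) :* P) refl x (eval p x)))
  where open ℚ-Solver

monomial : ℚ → ℕ → List ℚ
monomial c zero    = [ c ]
monomial c (suc k) = 0ℚ ∷ monomial c k

eval-monomial : ∀ c k x → eval (monomial c k) x ≡ c * x ^ k
eval-monomial c zero    x = solve 2 (λ c x → c :+ x :* con 0ℚ := c :* con 1ℚ) refl c x
  where open ℚ-Solver
eval-monomial c (suc k) x = trans (cong (λ e → 0ℚ + x * e) (eval-monomial c k x))
  (solve 3 (λ c x p → con 0ℚ :+ x :* (c :* p) := c :* (x :* p)) refl c x (x ^ k))
  where open ℚ-Solver

homogenizeCoeffs : ℕ → (ℕ → ℚ) → List ℚ
homogenizeCoeffs zero    D = [ D 0 ]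
homogenizeCoeffs (suc N) D = timesXMinus1 (homogenizeCoeffs N D) ⊕ monomial (D (suc N)) (suc N)

eval-homogenizeCoeffs : ∀ N D x → eval (homogenizeCoeffs N D) x ≡ homogenize N D x
eval-homogenizeCoeffs zero    D x = solve 2 (λ d x → d :+ x :* con 0ℚ := d :* (con 1ℚ :* con 1ℚ) :+ con 0ℚ) refl (D 0) x
  where open ℚ-Solver
eval-homogenizeCoeffs (suc N) D x = begin
  eval (timesXMinus1 (homogenizeCoeffs N D) ⊕ monomial (D (suc N)) (suc N)) x
    ≡⟨ eval-⊕ (timesXMinus1 (homogenizeCoeffs N D)) (monomial (D (suc N)) (suc N)) x ⟩
  eval (timesXMinus1 (homogenizeCoeffs N D)) x + eval (monomial (D (suc N)) (suc N)) x
    ≡⟨ cong₂ _+_ (trans (eval-timesXMinus1 (homogenizeCoeffs N D) x) (cong ((x - 1ℚ) *_) (eval-homogenizeCoeffs N D x)))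
                 (eval-monomial (D (suc N)) (suc N) x) ⟩
  (x - 1ℚ) * homogenize N D x + D (suc N) * x ^ suc N
    ≡⟨ homogenize-suc-last x N D ⟨
  homogenize (suc N) D x ∎
  where open ≡-Reasoning

-- Vanishing at x = 2, 3, … forces vanishing at x = 1, where only the top coefficient survives.
homogenize-vanishing-top : ∀ N D → (∀ m → homogenize N D (toℚ (2 ℕ.+ m)) ≡ 0ℚ) → D N ≡ 0ℚ
homogenize-vanishing-top N D zeros = begin
  D N                                 ≡⟨ homogenize-at-1 N D ⟨
  homogenize N D 1ℚ                   ≡⟨ eval-homogenizeCoeffs N D 1ℚ ⟨
  eval (homogenizeCoeffs N D) 1ℚ      ≡⟨ eval-allZero all-zero 1ℚ ⟩
  0ℚ                                  ∎
  where
  open ≡-Reasoning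
  all-zero : All (_≡ 0ℚ) (homogenizeCoeffs N D)
  all-zero = vanishing⇒allZero (toℚ ∘ (2 ℕ.+_)) (ℕP.+-cancelˡ-≡ 2 _ _ ∘ toℚ-injective) _
    (λ m → trans (eval-homogenizeCoeffs N D _) (zeros m))

homogenize-vanishing : ∀ N D → (∀ m → homogenize N D (toℚ (2 ℕ.+ m)) ≡ 0ℚ) → ∀ {j} → j ≤ N → D j ≡ 0ℚ
homogenize-vanishing N D zeros {j} j≤N with ℕP.m≤n⇒m<n∨m≡n j≤N
... | inj₂ refl = homogenize-vanishing-top N D zeros
homogenize-vanishing (suc N) D zeros {j} j≤N | inj₁ (s≤s j≤N′) =
  homogenize-vanishing N D lower-zeros j≤N′
  where
  lower-zeros : ∀ m → homogenize N D (toℚ (2 ℕ.+ m)) ≡ 0ℚ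
  lower-zeros m = p*q≡0⇒q≡0 x-1≢0 (begin
    (x - 1ℚ) * homogenize N D x                         ≡⟨ ℚP.+-identityʳ _ ⟨
    (x - 1ℚ) * homogenize N D x + 0ℚ                    ≡⟨ cong ((x - 1ℚ) * homogenize N D x +_) top≡0 ⟨
    (x - 1ℚ) * homogenize N D x + D (suc N) * x ^ suc N ≡⟨ homogenize-suc-last x N D ⟨
    homogenize (suc N) D x                              ≡⟨ zeros m ⟩
    0ℚ                                                  ∎)
    where
    open ≡-Reasoning
    x : ℚ
    x = toℚ (2 ℕ.+ m)
    top≡0 : D (suc N) * x ^ suc N ≡ 0ℚ
    top≡0 = trans (cong (_* x ^ suc N) (homogenize-vanishing-top (suc N) D zeros)) (ℚP.*-zeroˡ (x ^ suc N))
    x-1≢0 : x - 1ℚ ≢ 0ℚ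
    x-1≢0 eq = ℕP.1+n≢0 (toℚ-injective {suc m} {0} (trans (sym (toℚ[1+m]-1≡toℚ[m] (suc m))) eq))

homogenize-injective : ∀ N D D′ → (∀ m → homogenize N D (toℚ (2 ℕ.+ m)) ≡ homogenize N D′ (toℚ (2 ℕ.+ m))) →
                       ∀ {j} → j ≤ N → D j ≡ D′ j
homogenize-injective N D D′ agree j≤N = p-q≡0⇒p≡q (homogenize-vanishing N (D ⊖ D′)
  (λ m → trans (homogenize-⊖ _ N D D′) (trans (cong (_- homogenize N D′ (toℚ (2 ℕ.+ m))) (agree m))
                                                (ℚP.+-inverseʳ (homogenize N D′ (toℚ (2 ℕ.+ m)))))) j≤N)

treePoly-vanishes : ∀ N (a : List ℕ → ℚ) {k} → N < k → treePoly N a k ≡ 0ℚ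
treePoly-vanishes N a {k} N<k = trans (ℚ∑.∑-filterᵇ _ (partitions N) a)
  (trans (ℚ∑.∑-congᴬ (partitions N) (All.map short (partitions-IsPartitionOf N))) (ℚ∑.∑-zero (partitions N)))
  where
  short : ∀ {λs} → IsPartitionOf N λs → (if length λs ≡ᵇ k then a λs else 0ℚ) ≡ 0ℚ
  short {λs} ip with length λs ≡ᵇ k in eq
  ... | true  = ⊥-elim (ℕP.<⇒≢ (ℕP.≤-<-trans (IsPartitionOf-length ip) N<k)
                               (ℕP.≡ᵇ⇒≡ (length λs) k (subst T (sym eq) _)))
  ... | false = refl

module _ {n} (G : Graph (suc n)) {u v : Fin (suc n)} (uv : T (isEdge G u v)) (a b c : List ℕ → ℚ)
         (expansionG : IsPathExpansion G a) (expansionD : IsPathExpansion (delete G u v) b)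
         (expansionC : IsPathExpansion (contract G u v) c) where

  homogenize-deletion-contraction : ∀ m →
    homogenize (suc n) (treePoly (suc n) a) (toℚ (suc m)) ≡
    homogenize (suc n) (treePoly (suc n) b ⊖ xMinus1Times (treePoly n c)) (toℚ (suc m))
  homogenize-deletion-contraction m = begin
    homogenize (suc n) τG x
      ≡⟨ χ≡homogenize G a expansionG m ⟨
    toℚ (χ G (suc m))
      ≡⟨ solve 2 (λ g c → g := (g :+ c) :- c) refl (toℚ (χ G (suc m))) (toℚ (χ (contract G u v) (suc m))) ⟩
    toℚ (χ G (suc m)) + toℚ (χ (contract G u v) (suc m)) - toℚ (χ (contract G u v) (suc m))
      ≡⟨ cong (_- toℚ (χ (contract G u v) (suc m)))
              (trans (cong toℚ (DC.χ-delete (suc m))) (toℚ-+ (χ G (suc m)) (χ (contract G u v) (suc m)))) ⟨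
    toℚ (χ (delete G u v) (suc m)) - toℚ (χ (contract G u v) (suc m))
      ≡⟨ cong₂ _-_ (χ≡homogenize (delete G u v) b expansionD m) (χ≡homogenize (contract G u v) c expansionC m) ⟩
    homogenize (suc n) τD x - homogenize n τC x
      ≡⟨ cong (λ h → homogenize (suc n) τD x - h) homogenize-xMinus1Times-top ⟨
    homogenize (suc n) τD x - homogenize (suc n) (xMinus1Times τC) x
      ≡⟨ homogenize-⊖ x (suc n) τD (xMinus1Times τC) ⟨
    homogenize (suc n) (τD ⊖ xMinus1Times τC) x ∎
    where
    open ≡-Reasoning
    open ℚ-Solver
    module DC = DeletionContraction G uv
    x : ℚ
    x = toℚ (suc m)
    τG : ℕ → ℚ
    τG = treePoly (suc n) a
    τD : ℕ → ℚ
    τD = treePoly (suc n) b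
    τC : ℕ → ℚ
    τC = treePoly n c
    homogenize-xMinus1Times-top : homogenize (suc n) (xMinus1Times τC) x ≡ homogenize n τC x
    homogenize-xMinus1Times-top = begin
      homogenize (suc n) (xMinus1Times τC) x
        ≡⟨ homogenize-xMinus1Times x n τC ⟩
      homogenize n τC x - τC (suc n) * x ^ suc n
        ≡⟨ cong (λ t → homogenize n τC x - t * x ^ suc n) (treePoly-vanishes n c ℕP.≤-refl) ⟩
      homogenize n τC x - 0ℚ * x ^ suc n
        ≡⟨ solve 2 (λ h p → h :- con 0ℚ :* p := h) refl (homogenize n τC x) (x ^ suc n) ⟩
      homogenize n τC x ∎

theorem4p2 : ∀ {n : ℕ} (G : Graph (suc n)) (u v : Fin (suc n)) →
    isEdge G u v ≡ true →
    (a b c : List ℕ → ℚ) →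
    IsPathExpansion G a →
    IsPathExpansion (delete G u v) b →
    IsPathExpansion (contract G u v) c →
    ∀ (k : ℕ) → treePoly (suc n) a k ≡ (treePoly (suc n) b ⊖ xMinus1Times (treePoly n c)) k
theorem4p2 {n} G u v uv a b c expansionG expansionD expansionC k =
  [ low-degree , high-degree ]′ (ℕP.≤-<-connex k (suc n))
  where
  τ : ℕ → ℚ
  τ = treePoly (suc n) b ⊖ xMinus1Times (treePoly n c)
  low-degree : k ≤ suc n → treePoly (suc n) a k ≡ τ k
  low-degree = homogenize-injective (suc n) (treePoly (suc n) a) τ λ m →
    homogenize-deletion-contraction G {u} {v} (Equivalence.from BoolP.T-≡ uv) a b c expansionG expansionD expansionC (suc m)
  high-degree : suc n < k → treePoly (suc n) a k ≡ τ k
  high-degree (s≤s 1+n≤k′) = trans (treePoly-vanishes (suc n) a (s≤s 1+n≤k′)) (sym (cong₂ _-_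
    (treePoly-vanishes (suc n) b (s≤s 1+n≤k′))
    (cong₂ _-_ (treePoly-vanishes n c 1+n≤k′) (treePoly-vanishes n c (ℕP.m≤n⇒m≤1+n 1+n≤k′)))))
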